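{- Let $(\Omega,a)$ be a binding signature with associated endofunctor $\Sigma$ on $\mathcal B$ and let $[\eta_V,\varphi_V]:V+\Sigma(TV)\to TV$ be an initial $(V+\Sigma)$-algebra. Then $TV$ carries a (canonical) linear substitution algebra structure: there are morphisms $\sigma:\delta(TV)\hat\otimes TV\to TV$ and $\nu:J\to\delta(TV)$ such that $(TV,\sigma,\nu)$ is a linear substitution algebra.
   Context: Let $\mathbb{B}$ be the category whose objects are the sets $\mathbf{n}=\{1,\dots,n\}$ ($n\in\mathbb{N}$) and whose morphisms are bijections; symmetric strict monoidal with $\mathbf n\otimes\mathbf m=\mathbf{n+m}$ (elements of $\mathbf m$ after those of $\mathbf n$, morphisms blockwise), unit $\mathbf 0$; $s:\mathbf 2\to\mathbf 2$ the transposition. $\mathcal B=\mathbf{Set}^{\mathbb B}$. Day convolution $(X\hat\otimes Y)(\mathbf n)=\int^{\mathbf m_1,\mathbf m_2}X(\mathbf m_1)\times Y(\mathbf m_2)\times\mathbb B(\mathbf{m_1+m_2},\mathbf n)$, classes $[x,y,f]$, unit $J=\mathbb B(\mathbf 0,-)$; symmetric monoidal; associators suppressed, unitors $\lambda_X:J\hat\otimes X\to X$, $r_X:X\hat\otimes J\to X$, symmetry $\gamma$. $V=\mathbb B(\mathbf 1,-)$. $\delta:\mathcal B\to\mathcal B$, $\delta(X)(\mathbf n)=X(\mathbf{n+1})$, $\delta(X)(f)=X(f\otimes\mathrm{id}_{\mathbf 1})$. $\mathsf{swap}_X:\delta^2X\to\delta^2X$ has components $X(\mathrm{id}_{\mathbf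 n}\otimes s)$. Left strength $\mathsf{str}'_{X,Y}:X\hat\otimes\delta Y\to\delta(X\hat\otimes Y)$, $[x,y,f]\mapsto[x,y,f\otimes\mathrm{id}_{\mathbf 1}]$; right strength $\mathsf{str}_{X,Y}:\delta X\hat\otimes Y\to\delta(X\hat\otimes Y)$, $[x,y,f]\mapsto[x,y,(f\otimes\mathrm{id}_{\mathbf 1})\circ\theta]$ ($x\in X(\mathbf{m_1+1})$, $y\in Y(\mathbf m_2)$), $\theta:\mathbf{m_1+1+m_2}\to\mathbf{m_1+m_2+1}$ fixing $1..m_1$, $m_1+1\mapsto m_1+m_2+1$, $m_1+1+i\mapsto m_1+i$. A linear substitution algebra is $(X,\sigma,\nu)$ with $\sigma:\delta X\hat\otimes X\to X$, $\nu:J\to\delta X$, such that (a) $\sigma\circ(\nu\hat\otimes\mathrm{id})=\lambda_X$; (b) $\delta(\sigma)\circ\mathsf{str}'_{\delta X,X}\circ(\mathrm{id}\hat\otimes\nu)=r_{\delta X}$; (c) $\sigma\circ(\mathrm{id}_{\delta X}\hat\otimes\sigma)=\sigma\circ(\delta\sigma\hat\otimes\mathrm{id})\circ(\mathsf{str}'_{\delta X,X}\hat\otimes\mathrm{id})$ on $\delta X\hat\otimes\delta X\hat\otimes X$; (d) $\sigma\circ(\delta\sigma\hat\otimes\mathrm{id})\circ(\mathsf{str}_{\delta X,X}\hat\otimes\mathrm{id})=\sigma\circ(\delta\sigma\hat\otimes\mathrm{id})\circ(\mathsf{str}_{\delta X,X}\hat\otimes\mathrm{id})\circ(\mathrm{id}_{\delta^2X}\hat\otimes\gamma_{X,X})\circ(\mathsf{swap}_X\hat\otimes\mathrm{id}_{X\hat\otimes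 X})$ on $\delta^2X\hat\otimes X\hat\otimes X$. A binding signature is a set $\Omega$ with $a:\Omega\to\mathbb N^*$; for $a(\omega)=(n_1,\dots,n_k)$, $\Sigma_\omega(X)=\delta^{n_1}X\hat\otimes\cdots\hat\otimes\delta^{n_k}X$ ($J$ if $k=0$) and $\Sigma(X)=\coprod_{\omega}\Sigma_\omega(X)$. -}

module Defs where

open import Level using (0ℓ)
open import Data.Nat using (ℕ; zero; suc; _+_)
open import Data.Nat.Properties using (+-assoc; +-identityʳ)
open import Data.Fin using (Fin; splitAt; join; cast)
open import Data.Fin.Properties using (splitAt-join; join-splitAt; cast-involutive)
open import Data.Sum using (_⊎_; inj₁; inj₂)
import Data.Sum as Sum
open import Data.Sum.Properties using (swap-involutive)
open import Data.Product using (Σ; _,_; _×_)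
open import Data.List using (List; []; _∷_)
open import Function using (_↔_; mk↔ₛ′; Inverse)
open import Relation.Binary using (Setoid; Rel)
open import Relation.Binary.PropositionalEquality
  using (_≡_; refl; sym; trans; cong)
open import Relation.Binary.Construct.Closure.Equivalence using (EqClosure)
import Relation.Binary.Construct.Closure.Equivalence as EqC
open import Relation.Binary.Construct.Closure.Symmetric using (fwd; bwd)
open import Relation.Binary.Construct.Closure.ReflexiveTransitive using (ε; _◅_)

-- The groupoid 𝔹 of finite cardinals and bijections.

Perm : ℕ → ℕ → Set
Perm m n = Fin m ↔ Fin n

to : ∀ {m n} → Perm m n → Fin m → Fin n
to = Inverse.to

from : ∀ {m n} → Perm m n → Fin n → Fin m
from = Inverse.from

to-from : ∀ {m n} (f : Perm m n) y → to f (from f y) ≡ y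
to-from f y = Inverse.inverseˡ f refl

from-to : ∀ {m n} (f : Perm m n) x → from f (to f x) ≡ x
from-to f x = Inverse.inverseʳ f refl

infix 4 _≗ₚ_
_≗ₚ_ : ∀ {m n} → Perm m n → Perm m n → Set
f ≗ₚ g = ∀ i → to f i ≡ to g i

idP : ∀ {n} → Perm n n
idP = mk↔ₛ′ (λ i → i) (λ i → i) (λ _ → refl) (λ _ → refl)

infixr 9 _∘ₚ_
_∘ₚ_ : ∀ {m n o} → Perm n o → Perm m n → Perm m o
g ∘ₚ f = mk↔ₛ′ (λ i → to g (to f i)) (λ i → from f (from g i))
  (λ y → trans (cong (to g) (to-from f (from g y))) (to-from g y))
  (λ x → trans (cong (from f) (from-to g (to f x))) (from-to f x))

private
  mapmap : ∀ {A B C D : Set} (f : A → B) (g : B → A) (f' : C → D) (g' : D → C) →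
           (∀ y → f (g y) ≡ y) → (∀ y → f' (g' y) ≡ y) →
           ∀ s → Sum.map f f' (Sum.map g g' s) ≡ s
  mapmap f g f' g' p p' (inj₁ x) = cong inj₁ (p x)
  mapmap f g f' g' p p' (inj₂ y) = cong inj₂ (p' y)

  ⊕-inv : ∀ {m n m' n'} (f : Fin m → Fin m') (g : Fin m' → Fin m)
          (f' : Fin n → Fin n') (g' : Fin n' → Fin n) →
          (∀ y → f (g y) ≡ y) → (∀ y → f' (g' y) ≡ y) → ∀ y →
          join m' n' (Sum.map f f' (splitAt m (join m n (Sum.map g g' (splitAt m' y))))) ≡ y
  ⊕-inv {m} {n} {m'} {n'} f g f' g' p p' y
    rewrite splitAt-join m n (Sum.map g g' (splitAt m' y))
          | mapmap f g f' g' p p' (splitAt m' y) = join-splitAt m' n' y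

infixr 7 _⊕_
_⊕_ : ∀ {m m' n n'} → Perm m m' → Perm n n' → Perm (m + n) (m' + n')
_⊕_ {m} {m'} {n} {n'} a b =
  mk↔ₛ′ (λ i → join m' n' (Sum.map (to a) (to b) (splitAt m i)))
        (λ i → join m n (Sum.map (from a) (from b) (splitAt m' i)))
        (⊕-inv (to a) (from a) (to b) (from b) (to-from a) (to-from b))
        (⊕-inv (from a) (to a) (from b) (to b) (from-to a) (from-to b))

-- the bijection Fin m ↔ Fin n induced by an equation m ≡ n (the identity, up to
-- the strict identifications of the strict monoidal structure of 𝔹)
castP : ∀ {m n} → m ≡ n → Perm m n
castP eq = mk↔ₛ′ (cast eq) (cast (sym eq)) (cast-involutive eq (sym eq)) (cast-involutive (sym eq) eq)

symP : ∀ m n → Perm (m + n) (n + m)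
symP m n = mk↔ₛ′ (λ i → join n m (Sum.swap (splitAt m i))) (λ i → join m n (Sum.swap (splitAt n i)))
  (λ y → trans (cong (λ s → join n m (Sum.swap s)) (splitAt-join m n (Sum.swap (splitAt n y))))
               (trans (cong (join n m) (swap-involutive (splitAt n y))) (join-splitAt n m y)))
  (λ y → trans (cong (λ s → join m n (Sum.swap s)) (splitAt-join n m (Sum.swap (splitAt m y))))
               (trans (cong (join m n) (swap-involutive (splitAt m y))) (join-splitAt m n y)))

private
  tr : Fin 2 → Fin 2
  tr Fin.zero = Fin.suc Fin.zero
  tr (Fin.suc Fin.zero) = Fin.zero

  tr-inv : ∀ i → tr (tr i) ≡ i
  tr-inv Fin.zero = refl
  tr-inv (Fin.suc Fin.zero) = refl

s : Perm 2 2
s = mk↔ₛ′ tr tr tr-inv tr-inv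

swapPerm : ∀ n → Perm ((n + 1) + 1) ((n + 1) + 1)
swapPerm n = castP (sym (+-assoc n 1 1)) ∘ₚ (idP {n} ⊕ s) ∘ₚ castP (+-assoc n 1 1)

-- θ : m₁+1+m₂ → m₁+m₂+1 : fixes 1..m₁, m₁+1 ↦ m₁+m₂+1, m₁+1+i ↦ m₁+i
θ : ∀ m₁ m₂ → Perm ((m₁ + 1) + m₂) ((m₁ + m₂) + 1)
θ m₁ m₂ = castP (sym (+-assoc m₁ m₂ 1)) ∘ₚ (idP {m₁} ⊕ symP 1 m₂) ∘ₚ castP (+-assoc m₁ 1 m₂)

⊕-id : ∀ {m n} → (idP {m} ⊕ idP {n}) ≗ₚ idP
⊕-id {m} {n} i = trans (cong (join m n) (mapid (splitAt m i))) (join-splitAt m n i)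
  where
  mapid : ∀ (x : Fin m ⊎ Fin n) → Sum.map (λ j → j) (λ j → j) x ≡ x
  mapid (inj₁ _) = refl
  mapid (inj₂ _) = refl

⊕-∘ : ∀ {m m' m'' n n' n''} (g : Perm m' m'') (f : Perm m m') (g' : Perm n' n'') (f' : Perm n n') →
      ((g ∘ₚ f) ⊕ (g' ∘ₚ f')) ≗ₚ ((g ⊕ g') ∘ₚ (f ⊕ f'))
⊕-∘ {m} {m'} {m''} {n} {n'} {n''} g f g' f' i =
  cong (join m'' n'') (trans (mm (splitAt m i))
    (cong (Sum.map (to g) (to g')) (sym (splitAt-join m' n' (Sum.map (to f) (to f') (splitAt m i))))))
  where
  mm : ∀ x → Sum.map (λ j → to g (to f j)) (λ j → to g' (to f' j)) x
           ≡ Sum.map (to g) (to g') (Sum.map (to f) (to f') x)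
  mm (inj₁ _) = refl
  mm (inj₂ _) = refl

⊕-cong : ∀ {m m' n n'} {a a' : Perm m m'} {b b' : Perm n n'} → a ≗ₚ a' → b ≗ₚ b' → (a ⊕ b) ≗ₚ (a' ⊕ b')
⊕-cong {m} {m'} {n} {n'} {a} {a'} {b} {b'} p q i = cong (join m' n') (mm (splitAt m i))
  where
  mm : ∀ x → Sum.map (to a) (to b) x ≡ Sum.map (to a') (to b') x
  mm (inj₁ x) = cong inj₁ (p x)
  mm (inj₂ y) = cong inj₂ (q y)

-- 𝓑 = Set^𝔹 : functors 𝔹 → Set, with sets presented as setoids
-- (so that the coend defining Day convolution is an honest quotient).

record Species : Set₁ where
  field
    obj      : ℕ → Setoid 0ℓ 0ℓ
    act      : ∀ {m n} → Perm m n → Setoid.Carrier (obj m) → Setoid.Carrier (obj n)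
    act-cong : ∀ {m n} {f g : Perm m n} {x y} → f ≗ₚ g → Setoid._≈_ (obj m) x y →
               Setoid._≈_ (obj n) (act f x) (act g y)
    act-id   : ∀ {n} x → Setoid._≈_ (obj n) (act idP x) x
    act-∘    : ∀ {m n o} (g : Perm n o) (f : Perm m n) x →
               Setoid._≈_ (obj o) (act (g ∘ₚ f) x) (act g (act f x))

open Species public

El : Species → ℕ → Set
El X n = Setoid.Carrier (obj X n)

Eq : (X : Species) (n : ℕ) → El X n → El X n → Set
Eq X n = Setoid._≈_ (obj X n)

record Hom (X Y : Species) : Set where
  field
    fun      : ∀ {n} → El X n → El Y n
    fun-cong : ∀ {n} {x y} → Eq X n x y → Eq Y n (fun x) (fun y)
    natural  : ∀ {m n} (f : Perm m n) x → Eq Y n (fun (act X f x)) (act Y f (fun x))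

open Hom public

_≈ₕ_ : ∀ {X Y} → Hom X Y → Hom X Y → Set
_≈ₕ_ {X} {Y} h k = ∀ n (x : El X n) → Eq Y n (fun h x) (fun k x)

Rep : ℕ → Species
Rep k = record
  { obj = λ n → record { Carrier = Perm k n ; _≈_ = _≗ₚ_
                       ; isEquivalence = record { refl = λ _ → refl
                                                ; sym = λ p i → sym (p i)
                                                ; trans = λ p q i → trans (p i) (q i) } }
  ; act = λ f g → f ∘ₚ g
  ; act-cong = λ {_} {_} {f} {g} p q i → trans (cong (to f) (q i)) (p _)
  ; act-id = λ _ _ → refl
  ; act-∘ = λ _ _ _ _ → refl
  }

J : Species
J = Rep 0

V : Species
V = Rep 1

δ : Species → Species
δ X = record
  { obj = λ n → obj X (n + 1)
  ; act = λ f → act X (f ⊕ idP {1})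
  ; act-cong = λ {_} {_} {f} {g} p q → act-cong X (⊕-cong {a = f} {a' = g} {b = idP {1}} {b' = idP {1}} p (λ _ → refl)) q
  ; act-id = λ {n} x → Setoid.trans (obj X _) (act-cong X (⊕-id {n} {1}) (Setoid.refl (obj X _))) (act-id X x)
  ; act-∘ = λ g f x → Setoid.trans (obj X _) (act-cong X (⊕-∘ g f (idP {1}) (idP {1})) (Setoid.refl (obj X _)))
                                   (act-∘ X _ _ x)
  }

δ^ : ℕ → Species → Species
δ^ zero X = X
δ^ (suc k) X = δ (δ^ k X)

-- Day convolution as the coend  ∫^{m₁,m₂} X(m₁) × Y(m₂) × 𝔹(m₁+m₂, n)

record DayEl (X Y : Species) (n : ℕ) : Set where
  constructor day
  field
    {m₁ m₂} : ℕ
    x : El X m₁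
    y : El Y m₂
    f : Perm (m₁ + m₂) n

data DayR (X Y : Species) {n : ℕ} : Rel (DayEl X Y n) 0ℓ where
  gen : ∀ {m₁ m₂ m₁' m₂'} {x : El X m₁} {x' : El X m₁'} {y : El Y m₂} {y' : El Y m₂'}
          {f : Perm (m₁ + m₂) n} {f' : Perm (m₁' + m₂') n}
        (a : Perm m₁ m₁') (b : Perm m₂ m₂') →
        Eq X m₁' (act X a x) x' → Eq Y m₂' (act Y b y) y' → f ≗ₚ (f' ∘ₚ (a ⊕ b)) →
        DayR X Y (day x y f) (day x' y' f')

private
  dayStep : ∀ {X Y n m₁ m₂} {x : El X m₁} {y : El Y m₂} {h h' : Perm (m₁ + m₂) n} →
            h ≗ₚ h' → EqClosure (DayR X Y) (day x y h) (day x y h')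
  dayStep {X} {Y} {n} {m₁} {m₂} {h' = h'} p =
    fwd (gen idP idP (act-id X _) (act-id Y _) (λ i → trans (p i) (cong (to h') (sym (⊕-id {m₁} {m₂} i))))) ◅ ε

  dayAct : ∀ {X Y m n} → Perm m n → DayEl X Y m → DayEl X Y n
  dayAct g (day x y f) = day x y (g ∘ₚ f)

  dayActR : ∀ {X Y m n} (g : Perm m n) {e e' : DayEl X Y m} → DayR X Y e e' →
            DayR X Y (dayAct g e) (dayAct g e')
  dayActR g (gen a b p q r) = gen a b p q (λ i → cong (to g) (r i))

Day : Species → Species → Species
Day X Y = record
  { obj = λ n → record { Carrier = DayEl X Y n ; _≈_ = EqClosure (DayR X Y)
                       ; isEquivalence = EqC.isEquivalence (DayR X Y) }
  ; act = dayAct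
  ; act-cong = λ {m} {n} {f} {g} {e} {e'} p q →
      EqC.transitive (DayR X Y) (EqC.gmap {R = DayR X Y} {S = DayR X Y} (dayAct {X} {Y} {m} {n} f) (λ {e₁} {e₂} r → dayActR {X} {Y} {m} {n} f {e₁} {e₂} r) q) (cong-step {f = f} {g = g} p e')
  ; act-id = λ e → id-step e
  ; act-∘ = λ g f e → comp-step g f e
  }
  where
  cong-step : ∀ {m n} {f g : Perm m n} → f ≗ₚ g → (e : DayEl X Y m) →
              EqClosure (DayR X Y) (dayAct f e) (dayAct g e)
  cong-step p (day x y h) = dayStep (λ i → p (to h i))
  id-step : ∀ {n} (e : DayEl X Y n) → EqClosure (DayR X Y) (dayAct idP e) e
  id-step (day x y h) = dayStep (λ i → refl)
  comp-step : ∀ {m n o} (g : Perm n o) (f : Perm m n) (e : DayEl X Y m) →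
              EqClosure (DayR X Y) (dayAct (g ∘ₚ f) e) (dayAct g (dayAct f e))
  comp-step g f (day x y h) = dayStep (λ i → refl)

data ∐R {I : Set} (S : I → Species) (n : ℕ) : Rel (Σ I (λ i → El (S i) n)) 0ℓ where
  inj≈ : ∀ {i x y} → Eq (S i) n x y → ∐R S n (i , x) (i , y)

∐ : {I : Set} → (I → Species) → Species
∐ {I} S = record
  { obj = λ n → record { Carrier = Σ I (λ i → El (S i) n) ; _≈_ = ∐R S n
                       ; isEquivalence = record { refl = inj≈ (Setoid.refl (obj (S _) _))
                                                ; sym = λ { (inj≈ p) → inj≈ (Setoid.sym (obj (S _) _) p) }
                                                ; trans = λ { (inj≈ p) (inj≈ q) → inj≈ (Setoid.trans (obj (S _) _) p q) } } }
  ; act = λ { f (i , x) → i , act (S i) f x }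
  ; act-cong = λ { p (inj≈ q) → inj≈ (act-cong (S _) p q) }
  ; act-id = λ { (i , x) → inj≈ (act-id (S i) x) }
  ; act-∘ = λ { g f (i , x) → inj≈ (act-∘ (S i) g f x) }
  }

record BindingSig : Set₁ where
  field
    Op    : Set
    arity : Op → List ℕ

open BindingSig public

prodL : List ℕ → Species → Species
prodL [] X = J
prodL (k ∷ []) X = δ^ k X
prodL (k ∷ l ∷ ks) X = Day (δ^ k X) (prodL (l ∷ ks) X)

ΣF : BindingSig → Species → Species
ΣF S X = ∐ (λ ω → prodL (arity S ω) X)

δ^-map : ∀ k {A B} → (∀ {m} → El A m → El B m) → ∀ {m} → El (δ^ k A) m → El (δ^ k B) m
δ^-map zero h = h
δ^-map (suc k) h {m} = δ^-map k h {m + 1}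

prodL-map : ∀ ks {A B} → (∀ {m} → El A m → El B m) → ∀ {m} → El (prodL ks A) m → El (prodL ks B) m
prodL-map [] h e = e
prodL-map (k ∷ []) h e = δ^-map k h e
prodL-map (k ∷ l ∷ ks) h (day x y f) = day (δ^-map k h x) (prodL-map (l ∷ ks) h y) f

ΣF-map : ∀ S {A B} → (∀ {m} → El A m → El B m) → ∀ {m} → El (ΣF S A) m → El (ΣF S B) m
ΣF-map S h (ω , e) = ω , prodL-map (arity S ω) h e

IsAlgHom : ∀ S {A B} (a : Hom V A) (b : Hom (ΣF S A) A) (a' : Hom V B) (b' : Hom (ΣF S B) B) →
           Hom A B → Set
IsAlgHom S {A} {B} a b a' b' h =
  (∀ n (v : El V n) → Eq B n (fun h (fun a v)) (fun a' v)) ×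
  (∀ n (e : El (ΣF S A) n) → Eq B n (fun h (fun b e)) (fun b' (ΣF-map S (fun h) e)))

IsInitialAlg : ∀ S (T : Species) (η : Hom V T) (φ : Hom (ΣF S T) T) → Set₁
IsInitialAlg S T η φ =
  ∀ (A : Species) (a : Hom V A) (b : Hom (ΣF S A) A) →
  Σ (Hom T A) (λ h → IsAlgHom S η φ a b h ×
                     (∀ (h' : Hom T A) → IsAlgHom S η φ a b h' → h' ≈ₕ h))

_⊗₁_ : ∀ {X X' Y Y'} → (∀ {m} → El X m → El X' m) → (∀ {m} → El Y m → El Y' m) →
       ∀ {n} → DayEl X Y n → DayEl X' Y' n
(h ⊗₁ k) (day x y f) = day (h x) (k y) f

λ-rep : ∀ X {n} → DayEl J X n → El X n
λ-rep X (day {m₁} {m₂} j x f) = act X (f ∘ₚ (j ⊕ idP {m₂})) x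

r-rep : ∀ X {n} → DayEl X J n → El X n
r-rep X (day {m₁} {m₂} x j f) = act X (f ∘ₚ (idP {m₁} ⊕ j) ∘ₚ castP (sym (+-identityʳ m₁))) x

γ-rep : ∀ X Y {n} → DayEl X Y n → DayEl Y X n
γ-rep X Y (day {m₁} {m₂} x y f) = day y x (f ∘ₚ symP m₂ m₁)

assoc-rep : ∀ X Y Z {n} → DayEl (Day X Y) Z n → DayEl X (Day Y Z) n
assoc-rep X Y Z (day {_} {m₃} (day {m₁} {m₂} x y g) z f) =
  day x (day y z idP) (f ∘ₚ (g ⊕ idP {m₃}) ∘ₚ castP (sym (+-assoc m₁ m₂ m₃)))

assocInv-rep : ∀ X Y Z {n} → DayEl X (Day Y Z) n → DayEl (Day X Y) Z n
assocInv-rep X Y Z (day {m₁} {_} x (day {m₂} {m₃} y z h) f) =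
  day (day x y idP) z (f ∘ₚ (idP {m₁} ⊕ h) ∘ₚ castP (+-assoc m₁ m₂ m₃))

str'-rep : ∀ X Y {n} → DayEl X (δ Y) n → DayEl X Y (n + 1)
str'-rep X Y (day {m₁} {m₂} x y f) = day x y ((f ⊕ idP {1}) ∘ₚ castP (sym (+-assoc m₁ m₂ 1)))

str-rep : ∀ X Y {n} → DayEl (δ X) Y n → DayEl X Y (n + 1)
str-rep X Y (day {m₁} {m₂} x y f) = day x y ((f ⊕ idP {1}) ∘ₚ θ m₁ m₂)

swap-rep : ∀ X {n} → El (δ (δ X)) n → El (δ (δ X)) n
swap-rep X {n} = act X (swapPerm n)

-- linear substitution algebras; equations of morphisms checked on all
-- representatives (associators made explicit)

record IsLinSubstAlg (X : Species) (σ : Hom (Day (δ X) X) X) (ν : Hom J (δ X)) : Set where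
  δσstr' : ∀ {n} → DayEl (δ X) (δ X) n → El (δ X) n
  δσstr' e = fun σ (str'-rep (δ X) X e)
  δσstr : ∀ {n} → DayEl (δ (δ X)) X n → El (δ X) n
  δσstr e = fun σ (str-rep (δ X) X e)
  field
    law-a : ∀ n (e : DayEl J X n) →
            Eq X n (fun σ ((fun ν ⊗₁ (λ z → z)) e)) (λ-rep X e)
    law-b : ∀ n (e : DayEl (δ X) J n) →
            Eq (δ X) n (δσstr' (((λ z → z) ⊗₁ fun ν) e)) (r-rep (δ X) e)
    -- (c) σ ∘ (id ⊗ σ) ∘ α = σ ∘ (δσ ⊗ id) ∘ (str'_{δX,X} ⊗ id)   on (δX ⊗ δX) ⊗ X
    law-c : ∀ n (e : DayEl (Day (δ X) (δ X)) X n) →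
            Eq X n (fun σ (((λ z → z) ⊗₁ fun σ) (assoc-rep (δ X) (δ X) X e)))
                   (fun σ ((δσstr' ⊗₁ (λ z → z)) e))
    -- (d) L = L ∘ α⁻¹ ∘ (id ⊗ γ_{X,X}) ∘ (swap_X ⊗ id_{X⊗X}) ∘ α   on (δ²X ⊗ X) ⊗ X,
    --     where L = σ ∘ (δσ ⊗ id) ∘ (str_{δX,X} ⊗ id)
    law-d : ∀ n (e : DayEl (Day (δ (δ X)) X) X n) →
            Eq X n (fun σ ((δσstr ⊗₁ (λ z → z)) e))
                   (fun σ ((δσstr ⊗₁ (λ z → z))
                     (assocInv-rep (δ (δ X)) X X
                       ((_⊗₁_ {δ (δ X)} {δ (δ X)} {Day X X} {Day X X} (λ z → z) (γ-rep X X))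
                         ((swap-rep X ⊗₁ (λ z → z)) (assoc-rep (δ (δ X)) X X e))))))

{-# OPTIONS --safe #-}

-- The unique algebra map raw : T → Raw into raw syntax (terms with renaming as the action) is
-- injective: every variable of t occurs in raw t, so raw t determines how the variables of t are
-- distributed among the arguments of its head operator, which is exactly what a representative
-- of a Day convolution records. By induction, the image of raw is closed under substituting a term
-- for the last variable (that variable lies in exactly one argument), and this defines σ. The four
-- laws are then substitution lemmas of raw syntax, transported back along raw.

module Submission where

open import Defs
open import Data.Nat using (ℕ; zero; suc; _+_)
open import Data.Nat.Properties using (+-assoc; +-comm; +-identityʳ; +-cancelʳ-≡)
open import Data.Fin using (Fin; splitAt; join; _↑ˡ_; _↑ʳ_; toℕ; fromℕ)
open import Data.Fin.Properties
  using (splitAt-↑ˡ; splitAt-↑ʳ; splitAt⁻¹-↑ˡ; splitAt⁻¹-↑ʳ; ↑ˡ-injective; ↑ʳ-injective;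
         toℕ-injective; toℕ-↑ˡ; toℕ-↑ʳ; toℕ-cast; toℕ-fromℕ; _≟_)
open import Data.Fin.Permutation using (flip; transpose; ↔⇒≡)
import Data.Fin.Permutation.Components as PC
open import Data.Sum using (inj₁; inj₂)
import Data.Sum as Sum
open import Data.List using (List; []; _∷_)
open import Data.Unit using (⊤; tt)
open import Data.Empty using (⊥-elim)
open import Data.Product using (Σ; Σ-syntax; _,_; _×_; proj₁; proj₂)
open import Function using (_∘_; mk↔ₛ′)
open import Function.Definitions using (Injective)
open import Relation.Binary using (Setoid)
open import Relation.Binary.PropositionalEquality
  using (_≡_; _≢_; _≗_; refl; sym; trans; cong; cong₂; subst; subst₂; setoid; module ≡-Reasoning)
import Relation.Binary.Reasoning.Setoid as SetoidReasoning
open import Relation.Binary.Construct.Closure.Equivalence using (EqClosure)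
open import Relation.Binary.Construct.Closure.Symmetric using (fwd; bwd)
open import Relation.Binary.Construct.Closure.ReflexiveTransitive using (ε; _◅_)
open import Relation.Nullary.Decidable using (dec-true)

data Split (m n : ℕ) (i : Fin (m + n)) : Set where
  left  : ∀ j → i ≡ j ↑ˡ n → Split m n i
  right : ∀ j → i ≡ m ↑ʳ j → Split m n i

split : ∀ m n (i : Fin (m + n)) → Split m n i
split m n i with splitAt m i in eq
... | inj₁ j = left j (sym (splitAt⁻¹-↑ˡ eq))
... | inj₂ j = right j (sym (splitAt⁻¹-↑ʳ eq))

↑ˡ≢↑ʳ : ∀ {m n} {i : Fin m} {j : Fin n} → i ↑ˡ n ≢ m ↑ʳ j
↑ˡ≢↑ʳ {m} {n} {i} {j} eq with trans (sym (splitAt-↑ˡ m i n)) (trans (cong (splitAt m) eq) (splitAt-↑ʳ m n j))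
... | ()

Fin1-zero : (i : Fin 1) → i ≡ Fin.zero
Fin1-zero Fin.zero = refl

-- δ^ k X at a is X at a ⊹ k, i.e. at a + k bracketed as ((a + 1) + 1) + ⋯
_⊹_ : ℕ → ℕ → ℕ
a ⊹ zero = a
a ⊹ suc k = (a + 1) ⊹ k

extend : ∀ k {a b} → (Fin a → Fin b) → Fin (a + k) → Fin (b + k)
extend k {a} {b} ρ i = join b k (Sum.map ρ (λ z → z) (splitAt a i))

extend-↑ˡ : ∀ k {a b} (ρ : Fin a → Fin b) i → extend k ρ (i ↑ˡ k) ≡ ρ i ↑ˡ k
extend-↑ˡ k {a} {b} ρ i = cong (join b k ∘ Sum.map ρ (λ z → z)) (splitAt-↑ˡ a i k)

extend-↑ʳ : ∀ k {a b} (ρ : Fin a → Fin b) z → extend k ρ (a ↑ʳ z) ≡ b ↑ʳ z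
extend-↑ʳ k {a} {b} ρ z = cong (join b k ∘ Sum.map ρ (λ z → z)) (splitAt-↑ʳ a k z)

extend-unique : ∀ k {a b} {F : Fin (a + k) → Fin (b + k)} (ρ : Fin a → Fin b) →
                (∀ i → F (i ↑ˡ k) ≡ ρ i ↑ˡ k) → (∀ z → F (a ↑ʳ z) ≡ b ↑ʳ z) → F ≗ extend k ρ
extend-unique k {a} ρ F-left F-right i with split a k i
... | left j refl = trans (F-left j) (sym (extend-↑ˡ k ρ j))
... | right z refl = trans (F-right z) (sym (extend-↑ʳ k ρ z))

liftRen₁ : ∀ {a b} → (Fin a → Fin b) → Fin (a + 1) → Fin (b + 1)
liftRen₁ = extend 1

liftRen : ∀ k {a b} → (Fin a → Fin b) → Fin (a ⊹ k) → Fin (b ⊹ k)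
liftRen zero ρ = ρ
liftRen (suc k) ρ = liftRen k (liftRen₁ ρ)

weaken : ∀ k {a} → Fin a → Fin (a ⊹ k)
weaken zero i = i
weaken (suc k) i = weaken k (i ↑ˡ 1)

liftRen₁-↑ˡ : ∀ {a b} (ρ : Fin a → Fin b) i → liftRen₁ ρ (i ↑ˡ 1) ≡ ρ i ↑ˡ 1
liftRen₁-↑ˡ = extend-↑ˡ 1

liftRen₁-↑ʳ : ∀ {a b} (ρ : Fin a → Fin b) z → liftRen₁ ρ (a ↑ʳ z) ≡ b ↑ʳ z
liftRen₁-↑ʳ = extend-↑ʳ 1

liftRen₁-cong : ∀ {a b} {ρ ρ′ : Fin a → Fin b} → ρ ≗ ρ′ → liftRen₁ ρ ≗ liftRen₁ ρ′
liftRen₁-cong {a} {ρ = ρ} {ρ′} eq i with split a 1 i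
... | left j refl = trans (liftRen₁-↑ˡ ρ j) (trans (cong (_↑ˡ 1) (eq j)) (sym (liftRen₁-↑ˡ ρ′ j)))
... | right z refl = trans (liftRen₁-↑ʳ ρ z) (sym (liftRen₁-↑ʳ ρ′ z))

liftRen₁-id : ∀ {a} → liftRen₁ {a} (λ i → i) ≗ (λ i → i)
liftRen₁-id {a} i with split a 1 i
... | left j refl = liftRen₁-↑ˡ (λ i → i) j
... | right z refl = liftRen₁-↑ʳ (λ i → i) z

liftRen₁-∘ : ∀ {a b c} (ρ : Fin b → Fin c) (τ : Fin a → Fin b) →
             liftRen₁ (ρ ∘ τ) ≗ liftRen₁ ρ ∘ liftRen₁ τ
liftRen₁-∘ {a} ρ τ i with split a 1 i
... | left j refl =
  trans (liftRen₁-↑ˡ (ρ ∘ τ) j) (sym (trans (cong (liftRen₁ ρ) (liftRen₁-↑ˡ τ j)) (liftRen₁-↑ˡ ρ (τ j))))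
... | right z refl =
  trans (liftRen₁-↑ʳ (ρ ∘ τ) z) (sym (trans (cong (liftRen₁ ρ) (liftRen₁-↑ʳ τ z)) (liftRen₁-↑ʳ ρ z)))

liftRen₁-injective : ∀ {a b} {ρ : Fin a → Fin b} → Injective _≡_ _≡_ ρ → Injective _≡_ _≡_ (liftRen₁ ρ)
liftRen₁-injective {a} {b} {ρ} inj {x} {y} eq with split a 1 x | split a 1 y
... | left i refl | left j refl =
  cong (_↑ˡ 1) (inj (↑ˡ-injective 1 _ _ (trans (sym (liftRen₁-↑ˡ ρ i)) (trans eq (liftRen₁-↑ˡ ρ j)))))
... | left i refl | right z refl = ⊥-elim (↑ˡ≢↑ʳ (trans (sym (liftRen₁-↑ˡ ρ i)) (trans eq (liftRen₁-↑ʳ ρ z))))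
... | right z refl | left j refl = ⊥-elim (↑ˡ≢↑ʳ (trans (sym (liftRen₁-↑ˡ ρ j)) (trans (sym eq) (liftRen₁-↑ʳ ρ z))))
... | right z refl | right z′ refl =
  cong (a ↑ʳ_) (↑ʳ-injective b _ _ (trans (sym (liftRen₁-↑ʳ ρ z)) (trans eq (liftRen₁-↑ʳ ρ z′))))

liftRen-cong : ∀ k {a b} {ρ ρ′ : Fin a → Fin b} → ρ ≗ ρ′ → liftRen k ρ ≗ liftRen k ρ′
liftRen-cong zero eq = eq
liftRen-cong (suc k) eq = liftRen-cong k (liftRen₁-cong eq)

liftRen-id : ∀ k {a} → liftRen k {a} (λ i → i) ≗ (λ i → i)
liftRen-id zero i = refl
liftRen-id (suc k) i = trans (liftRen-cong k liftRen₁-id i) (liftRen-id k i)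

liftRen-∘ : ∀ k {a b c} (ρ : Fin b → Fin c) (τ : Fin a → Fin b) →
            liftRen k (ρ ∘ τ) ≗ liftRen k ρ ∘ liftRen k τ
liftRen-∘ zero ρ τ i = refl
liftRen-∘ (suc k) ρ τ i = trans (liftRen-cong k (liftRen₁-∘ ρ τ) i) (liftRen-∘ k (liftRen₁ ρ) (liftRen₁ τ) i)

liftRen-injective : ∀ k {a b} {ρ : Fin a → Fin b} → Injective _≡_ _≡_ ρ → Injective _≡_ _≡_ (liftRen k ρ)
liftRen-injective zero inj = inj
liftRen-injective (suc k) inj = liftRen-injective k (liftRen₁-injective inj)

liftRen-weaken : ∀ k {a b} (ρ : Fin a → Fin b) i → liftRen k ρ (weaken k i) ≡ weaken k (ρ i)
liftRen-weaken zero ρ i = refl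
liftRen-weaken (suc k) ρ i = trans (liftRen-weaken k (liftRen₁ ρ) (i ↑ˡ 1)) (cong (weaken k) (liftRen₁-↑ˡ ρ i))

liftRen-weaken⁻ : ∀ k {a b} (ρ : Fin a → Fin b) j ℓ → liftRen k ρ j ≡ weaken k ℓ →
                  Σ[ i ∈ Fin a ] j ≡ weaken k i × ρ i ≡ ℓ
liftRen-weaken⁻ zero ρ j ℓ eq = j , refl , eq
liftRen-weaken⁻ (suc k) {a} ρ j ℓ eq with liftRen-weaken⁻ k (liftRen₁ ρ) j (ℓ ↑ˡ 1) eq
... | i′ , j≡i′ , ρi′≡ℓ with split a 1 i′
...   | left i refl = i , j≡i′ , ↑ˡ-injective 1 _ _ (trans (sym (liftRen₁-↑ˡ ρ i)) ρi′≡ℓ)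
...   | right z refl = ⊥-elim (↑ˡ≢↑ʳ (trans (sym ρi′≡ℓ) (liftRen₁-↑ʳ ρ z)))

to-⊕-↑ˡ : ∀ {m m′ n n′} (a : Perm m m′) (b : Perm n n′) i → to (a ⊕ b) (i ↑ˡ n) ≡ to a i ↑ˡ n′
to-⊕-↑ˡ {m} {m′} {n} {n′} a b i = cong (join m′ n′ ∘ Sum.map (to a) (to b)) (splitAt-↑ˡ m i n)

to-⊕-↑ʳ : ∀ {m m′ n n′} (a : Perm m m′) (b : Perm n n′) j → to (a ⊕ b) (m ↑ʳ j) ≡ m′ ↑ʳ to b j
to-⊕-↑ʳ {m} {m′} {n} {n′} a b j = cong (join m′ n′ ∘ Sum.map (to a) (to b)) (splitAt-↑ʳ m n j)

to-injective : ∀ {m n} (g : Perm m n) → Injective _≡_ _≡_ (to g)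
to-injective g {x} {y} eq = trans (sym (from-to g x)) (trans (cong (from g) eq) (from-to g y))

from-≡ : ∀ {m n} (g : Perm m n) {x y} → to g x ≡ y → from g y ≡ x
from-≡ g {x} eq = trans (cong (from g) (sym eq)) (from-to g x)

castP-toℕ : ∀ {m n} (eq : m ≡ n) {x : Fin m} {y : Fin n} → toℕ x ≡ toℕ y → to (castP eq) x ≡ y
castP-toℕ eq {x} p = toℕ-injective (trans (toℕ-cast eq x) p)

module _ (a b c : ℕ) where
  private
    toℕ-↑ˡ↑ˡ : (i : Fin a) → toℕ ((i ↑ˡ b) ↑ˡ c) ≡ toℕ (i ↑ˡ (b + c))
    toℕ-↑ˡ↑ˡ i = trans (toℕ-↑ˡ (i ↑ˡ b) c) (trans (toℕ-↑ˡ i b) (sym (toℕ-↑ˡ i (b + c))))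

    toℕ-↑ʳ↑ˡ : (j : Fin b) → toℕ ((a ↑ʳ j) ↑ˡ c) ≡ toℕ (a ↑ʳ (j ↑ˡ c))
    toℕ-↑ʳ↑ˡ j = trans (toℕ-↑ˡ (a ↑ʳ j) c) (trans (toℕ-↑ʳ a j) (sym (trans (toℕ-↑ʳ a (j ↑ˡ c)) (cong (a +_) (toℕ-↑ˡ j c)))))

    toℕ-↑ʳ↑ʳ : (z : Fin c) → toℕ ((a + b) ↑ʳ z) ≡ toℕ (a ↑ʳ (b ↑ʳ z))
    toℕ-↑ʳ↑ʳ z = trans (toℕ-↑ʳ (a + b) z) (trans (+-assoc a b (toℕ z)) (sym (trans (toℕ-↑ʳ a (b ↑ʳ z)) (cong (a +_) (toℕ-↑ʳ b z)))))

  assoc-↑ˡ : ∀ i → to (castP (+-assoc a b c)) ((i ↑ˡ b) ↑ˡ c) ≡ i ↑ˡ (b + c)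
  assoc-↑ˡ i = castP-toℕ (+-assoc a b c) (toℕ-↑ˡ↑ˡ i)

  assoc-↑ʳ↑ˡ : ∀ j → to (castP (+-assoc a b c)) ((a ↑ʳ j) ↑ˡ c) ≡ a ↑ʳ (j ↑ˡ c)
  assoc-↑ʳ↑ˡ j = castP-toℕ (+-assoc a b c) (toℕ-↑ʳ↑ˡ j)

  assoc-↑ʳ : ∀ z → to (castP (+-assoc a b c)) ((a + b) ↑ʳ z) ≡ a ↑ʳ (b ↑ʳ z)
  assoc-↑ʳ z = castP-toℕ (+-assoc a b c) (toℕ-↑ʳ↑ʳ z)

  unassoc-↑ˡ : ∀ i → to (castP (sym (+-assoc a b c))) (i ↑ˡ (b + c)) ≡ (i ↑ˡ b) ↑ˡ c
  unassoc-↑ˡ i = castP-toℕ (sym (+-assoc a b c)) (sym (toℕ-↑ˡ↑ˡ i))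

  unassoc-↑ʳ↑ˡ : ∀ j → to (castP (sym (+-assoc a b c))) (a ↑ʳ (j ↑ˡ c)) ≡ (a ↑ʳ j) ↑ˡ c
  unassoc-↑ʳ↑ˡ j = castP-toℕ (sym (+-assoc a b c)) (sym (toℕ-↑ʳ↑ˡ j))

  unassoc-↑ʳ : ∀ z → to (castP (sym (+-assoc a b c))) (a ↑ʳ (b ↑ʳ z)) ≡ (a + b) ↑ʳ z
  unassoc-↑ʳ z = castP-toℕ (sym (+-assoc a b c)) (sym (toℕ-↑ʳ↑ʳ z))

symP-↑ˡ : ∀ m n (i : Fin m) → to (symP m n) (i ↑ˡ n) ≡ n ↑ʳ i
symP-↑ˡ m n i = cong (join n m ∘ Sum.swap) (splitAt-↑ˡ m i n)

symP-↑ʳ : ∀ m n (j : Fin n) → to (symP m n) (m ↑ʳ j) ≡ j ↑ˡ m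
symP-↑ʳ m n j = cong (join n m ∘ Sum.swap) (splitAt-↑ʳ m n j)

-- θ a c is exchange a 1 c
exchange : ∀ a k c → Perm ((a + k) + c) ((a + c) + k)
exchange a k c = castP (sym (+-assoc a c k)) ∘ₚ (idP {a} ⊕ symP k c) ∘ₚ castP (+-assoc a k c)

module _ (a k c : ℕ) where
  private
    outer : Perm (a + (c + k)) ((a + c) + k)
    outer = castP (sym (+-assoc a c k))
    middle : Perm (a + (k + c)) (a + (c + k))
    middle = idP {a} ⊕ symP k c

  exchange-↑ˡ : ∀ i → to (exchange a k c) ((i ↑ˡ k) ↑ˡ c) ≡ (i ↑ˡ c) ↑ˡ k
  exchange-↑ˡ i = begin
    to outer (to middle (to (castP (+-assoc a k c)) ((i ↑ˡ k) ↑ˡ c))) ≡⟨ cong (to outer ∘ to middle) (assoc-↑ˡ a k c i) ⟩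
    to outer (to middle (i ↑ˡ (k + c)))                                ≡⟨ cong (to outer) (to-⊕-↑ˡ idP (symP k c) i) ⟩
    to outer (i ↑ˡ (c + k))                                            ≡⟨ unassoc-↑ˡ a c k i ⟩
    (i ↑ˡ c) ↑ˡ k                                                      ∎
    where open ≡-Reasoning

  exchange-↑ʳ↑ˡ : ∀ z → to (exchange a k c) ((a ↑ʳ z) ↑ˡ c) ≡ (a + c) ↑ʳ z
  exchange-↑ʳ↑ˡ z = begin
    to outer (to middle (to (castP (+-assoc a k c)) ((a ↑ʳ z) ↑ˡ c))) ≡⟨ cong (to outer ∘ to middle) (assoc-↑ʳ↑ˡ a k c z) ⟩
    to outer (to middle (a ↑ʳ (z ↑ˡ c)))                               ≡⟨ cong (to outer) (to-⊕-↑ʳ idP (symP k c) (z ↑ˡ c)) ⟩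
    to outer (a ↑ʳ to (symP k c) (z ↑ˡ c))                             ≡⟨ cong (to outer ∘ (a ↑ʳ_)) (symP-↑ˡ k c z) ⟩
    to outer (a ↑ʳ (c ↑ʳ z))                                           ≡⟨ unassoc-↑ʳ a c k z ⟩
    (a + c) ↑ʳ z                                                       ∎
    where open ≡-Reasoning

  exchange-↑ʳ : ∀ j → to (exchange a k c) ((a + k) ↑ʳ j) ≡ (a ↑ʳ j) ↑ˡ k
  exchange-↑ʳ j = begin
    to outer (to middle (to (castP (+-assoc a k c)) ((a + k) ↑ʳ j))) ≡⟨ cong (to outer ∘ to middle) (assoc-↑ʳ a k c j) ⟩
    to outer (to middle (a ↑ʳ (k ↑ʳ j)))                              ≡⟨ cong (to outer) (to-⊕-↑ʳ idP (symP k c) (k ↑ʳ j)) ⟩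
    to outer (a ↑ʳ to (symP k c) (k ↑ʳ j))                            ≡⟨ cong (to outer ∘ (a ↑ʳ_)) (symP-↑ʳ k c j) ⟩
    to outer (a ↑ʳ (j ↑ˡ k))                                          ≡⟨ unassoc-↑ʳ↑ˡ a c k j ⟩
    (a ↑ʳ j) ↑ˡ k                                                     ∎
    where open ≡-Reasoning

module _ {n : ℕ} where
  private
    outer : Perm (n + 2) ((n + 1) + 1)
    outer = castP (sym (+-assoc n 1 1))
    middle : Perm (n + 2) (n + 2)
    middle = idP {n} ⊕ s

  swapPerm-↑ˡ : ∀ i → to (swapPerm n) ((i ↑ˡ 1) ↑ˡ 1) ≡ (i ↑ˡ 1) ↑ˡ 1
  swapPerm-↑ˡ i = begin
    to outer (to middle (to (castP (+-assoc n 1 1)) ((i ↑ˡ 1) ↑ˡ 1))) ≡⟨ cong (to outer ∘ to middle) (assoc-↑ˡ n 1 1 i) ⟩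
    to outer (to middle (i ↑ˡ 2))                                      ≡⟨ cong (to outer) (to-⊕-↑ˡ idP s i) ⟩
    to outer (i ↑ˡ 2)                                                  ≡⟨ unassoc-↑ˡ n 1 1 i ⟩
    (i ↑ˡ 1) ↑ˡ 1                                                      ∎
    where open ≡-Reasoning

  swapPerm-↑ʳ↑ˡ : ∀ z → to (swapPerm n) ((n ↑ʳ z) ↑ˡ 1) ≡ (n + 1) ↑ʳ z
  swapPerm-↑ʳ↑ˡ Fin.zero = begin
    to outer (to middle (to (castP (+-assoc n 1 1)) ((n ↑ʳ Fin.zero) ↑ˡ 1))) ≡⟨ cong (to outer ∘ to middle) (assoc-↑ʳ↑ˡ n 1 1 Fin.zero) ⟩
    to outer (to middle (n ↑ʳ Fin.zero))                                      ≡⟨ cong (to outer) (to-⊕-↑ʳ idP s Fin.zero) ⟩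
    to outer (n ↑ʳ (1 ↑ʳ Fin.zero))                                           ≡⟨ unassoc-↑ʳ n 1 1 Fin.zero ⟩
    (n + 1) ↑ʳ Fin.zero                                                       ∎
    where open ≡-Reasoning

  swapPerm-↑ʳ : ∀ z → to (swapPerm n) ((n + 1) ↑ʳ z) ≡ (n ↑ʳ z) ↑ˡ 1
  swapPerm-↑ʳ Fin.zero = begin
    to outer (to middle (to (castP (+-assoc n 1 1)) ((n + 1) ↑ʳ Fin.zero))) ≡⟨ cong (to outer ∘ to middle) (assoc-↑ʳ n 1 1 Fin.zero) ⟩
    to outer (to middle (n ↑ʳ (1 ↑ʳ Fin.zero)))                              ≡⟨ cong (to outer) (to-⊕-↑ʳ idP s (1 ↑ʳ Fin.zero)) ⟩
    to outer (n ↑ʳ Fin.zero)                                                 ≡⟨ unassoc-↑ʳ↑ˡ n 1 1 Fin.zero ⟩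
    (n ↑ʳ Fin.zero) ↑ˡ 1                                                     ∎
    where open ≡-Reasoning

moveLast : ∀ {a} (i : Fin (suc a)) → Perm (suc a) (a + 1)
moveLast {a} i = castP (+-comm 1 a) ∘ₚ transpose i (fromℕ a)

moveLast-moves : ∀ {a} (i : Fin (suc a)) → to (moveLast i) i ≡ a ↑ʳ Fin.zero
moveLast-moves {a} i = castP-toℕ (+-comm 1 a) (begin
  toℕ (PC.transpose i (fromℕ a) i) ≡⟨ cong toℕ transpose-i ⟩
  toℕ (fromℕ a)                    ≡⟨ toℕ-fromℕ a ⟩
  a                                ≡⟨ +-identityʳ a ⟨
  a + 0                            ≡⟨ toℕ-↑ʳ a Fin.zero ⟨
  toℕ (a ↑ʳ Fin.zero)              ∎)
  where
  open ≡-Reasoning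
  transpose-i : PC.transpose i (fromℕ a) i ≡ fromℕ a
  transpose-i rewrite dec-true (i ≟ i) refl = refl

restrict : ∀ {m n a a′} (π : Perm m n) {e : Fin a → Fin m} {e′ : Fin a′ → Fin n} →
           Injective _≡_ _≡_ e → Injective _≡_ _≡_ e′ →
           (∀ i → Σ[ j ∈ Fin a′ ] to π (e i) ≡ e′ j) → (∀ j → Σ[ i ∈ Fin a ] from π (e′ j) ≡ e i) →
           Perm a a′
restrict π e-inj e′-inj forth back = mk↔ₛ′ (proj₁ ∘ forth) (proj₁ ∘ back)
  (λ j → e′-inj (trans (sym (proj₂ (forth _))) (trans (cong (to π) (sym (proj₂ (back j)))) (to-from π _))))
  (λ i → e-inj (trans (sym (proj₂ (back _))) (trans (cong (from π) (sym (proj₂ (forth i)))) (from-to π _))))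

module _ {a c a′ c′} (π : Perm (a + c) (a′ + c′)) where
  preserves-right : (∀ j → Σ[ i ∈ Fin a ] from π (j ↑ˡ c′) ≡ i ↑ˡ c) →
                    ∀ j → Σ[ j′ ∈ Fin c′ ] to π (a ↑ʳ j) ≡ a′ ↑ʳ j′
  preserves-right from-left j with split a′ c′ (to π (a ↑ʳ j))
  ... | right j′ eq = j′ , eq
  ... | left i′ eq = ⊥-elim (↑ˡ≢↑ʳ (trans (sym (proj₂ (from-left i′))) (from-≡ π eq)))

  preserves-left : (∀ j → Σ[ i ∈ Fin c ] from π (a′ ↑ʳ j) ≡ a ↑ʳ i) →
                   ∀ i → Σ[ i′ ∈ Fin a′ ] to π (i ↑ˡ c) ≡ i′ ↑ˡ c′
  preserves-left from-right i with split a′ c′ (to π (i ↑ˡ c))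
  ... | left i′ eq = i′ , eq
  ... | right j′ eq = ⊥-elim (↑ˡ≢↑ʳ (trans (sym (from-≡ π eq)) (proj₂ (from-right j′))))

module BlockDecomposition {a c a′ c′} (π : Perm (a + c) (a′ + c′))
  (to-left : ∀ i → Σ[ i′ ∈ Fin a′ ] to π (i ↑ˡ c) ≡ i′ ↑ˡ c′)
  (from-left : ∀ j → Σ[ i ∈ Fin a ] from π (j ↑ˡ c′) ≡ i ↑ˡ c) where

  leftPart : Perm a a′
  leftPart = restrict π (↑ˡ-injective c _ _) (↑ˡ-injective c′ _ _) to-left from-left

  rightPart : Perm c c′
  rightPart = restrict π (↑ʳ-injective a _ _) (↑ʳ-injective a′ _ _)
    (preserves-right π from-left) (preserves-right (flip π) to-left)

  decomposition : to π ≗ to (leftPart ⊕ rightPart)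
  decomposition x with split a c x
  ... | left i refl = trans (proj₂ (to-left i)) (sym (to-⊕-↑ˡ leftPart rightPart i))
  ... | right j refl = trans (proj₂ (preserves-right π from-left j)) (sym (to-⊕-↑ʳ leftPart rightPart j))

module _ {n m} (K : Perm (n + 1) (m + 1)) (fixes-last : to K (n ↑ʳ Fin.zero) ≡ m ↑ʳ Fin.zero) where
  private
    last-to-last : ∀ j → Σ[ i ∈ Fin 1 ] from (flip K) (n ↑ʳ j) ≡ m ↑ʳ i
    last-to-last j = Fin.zero , trans (cong (to K ∘ (n ↑ʳ_)) (Fin1-zero j)) fixes-last

    last-from-last : ∀ j → Σ[ i ∈ Fin 1 ] from K (m ↑ʳ j) ≡ n ↑ʳ i
    last-from-last j = Fin.zero , trans (cong (from K ∘ (m ↑ʳ_)) (Fin1-zero j)) (from-≡ K fixes-last)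

  restrictLast : Perm n m
  restrictLast = BlockDecomposition.leftPart K (preserves-left K last-from-last) (preserves-left (flip K) last-to-last)

  restrictLast-↑ˡ : ∀ i → to K (i ↑ˡ 1) ≡ to restrictLast i ↑ˡ 1
  restrictLast-↑ˡ i = proj₂ (preserves-left K last-from-last i)

-- reassoc 1 g is the permutation of str′, and reassoc c g that of the associator
module _ {a b n : ℕ} where
  reassoc : ∀ c → Perm (a + b) n → Perm (a + (b + c)) (n + c)
  reassoc c g = (g ⊕ idP {c}) ∘ₚ castP (sym (+-assoc a b c))

  reassoc-↑ˡ : ∀ c (g : Perm (a + b) n) i → to (reassoc c g) (i ↑ˡ (b + c)) ≡ to g (i ↑ˡ b) ↑ˡ c
  reassoc-↑ˡ c g i = trans (cong (to (g ⊕ idP)) (unassoc-↑ˡ a b c i)) (to-⊕-↑ˡ g idP (i ↑ˡ b))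

  reassoc-↑ʳ↑ˡ : ∀ c (g : Perm (a + b) n) j → to (reassoc c g) (a ↑ʳ (j ↑ˡ c)) ≡ to g (a ↑ʳ j) ↑ˡ c
  reassoc-↑ʳ↑ˡ c g j = trans (cong (to (g ⊕ idP)) (unassoc-↑ʳ↑ˡ a b c j)) (to-⊕-↑ˡ g idP (a ↑ʳ j))

  reassoc-↑ʳ↑ʳ : ∀ c (g : Perm (a + b) n) z → to (reassoc c g) (a ↑ʳ (b ↑ʳ z)) ≡ n ↑ʳ z
  reassoc-↑ʳ↑ʳ c g z = trans (cong (to (g ⊕ idP)) (unassoc-↑ʳ a b c z)) (to-⊕-↑ʳ g idP z)

module _ {a b n : ℕ} where
  -- sendBack 1 g is the permutation of str
  sendBack : ∀ k → Perm (a + b) n → Perm ((a + k) + b) (n + k)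
  sendBack k g = (g ⊕ idP {k}) ∘ₚ exchange a k b

  sendBack-↑ˡ : ∀ k (g : Perm (a + b) n) i → to (sendBack k g) ((i ↑ˡ k) ↑ˡ b) ≡ to g (i ↑ˡ b) ↑ˡ k
  sendBack-↑ˡ k g i = trans (cong (to (g ⊕ idP)) (exchange-↑ˡ a k b i)) (to-⊕-↑ˡ g idP (i ↑ˡ b))

  sendBack-↑ʳ↑ˡ : ∀ k (g : Perm (a + b) n) z → to (sendBack k g) ((a ↑ʳ z) ↑ˡ b) ≡ n ↑ʳ z
  sendBack-↑ʳ↑ˡ k g z = trans (cong (to (g ⊕ idP)) (exchange-↑ʳ↑ˡ a k b z)) (to-⊕-↑ʳ g idP z)

  sendBack-↑ʳ : ∀ k (g : Perm (a + b) n) j → to (sendBack k g) ((a + k) ↑ʳ j) ≡ to g (a ↑ʳ j) ↑ˡ k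
  sendBack-↑ʳ k g j = trans (cong (to (g ⊕ idP)) (exchange-↑ʳ a k b j)) (to-⊕-↑ˡ g idP (a ↑ʳ j))

-- the permutation that α⁻¹ ∘ (id ⊗ γ) ∘ α puts on representatives
assocSwap : ∀ a c b → Perm ((a + c) + b) (a + (b + c))
assocSwap a c b = (idP {a} ⊕ (idP ∘ₚ symP c b)) ∘ₚ castP (+-assoc a c b)

module _ (a c b : ℕ) where
  private
    inner : Perm (a + (c + b)) (a + (b + c))
    inner = idP {a} ⊕ (idP ∘ₚ symP c b)

  assocSwap-↑ˡ : ∀ i → to (assocSwap a c b) ((i ↑ˡ c) ↑ˡ b) ≡ i ↑ˡ (b + c)
  assocSwap-↑ˡ i = trans (cong (to inner) (assoc-↑ˡ a c b i)) (to-⊕-↑ˡ idP (idP ∘ₚ symP c b) i)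

  assocSwap-↑ʳ↑ˡ : ∀ q → to (assocSwap a c b) ((a ↑ʳ q) ↑ˡ b) ≡ a ↑ʳ (b ↑ʳ q)
  assocSwap-↑ʳ↑ˡ q = trans (cong (to inner) (assoc-↑ʳ↑ˡ a c b q))
    (trans (to-⊕-↑ʳ idP (idP ∘ₚ symP c b) (q ↑ˡ b)) (cong (a ↑ʳ_) (symP-↑ˡ c b q)))

  assocSwap-↑ʳ : ∀ j → to (assocSwap a c b) ((a + c) ↑ʳ j) ≡ a ↑ʳ (j ↑ˡ c)
  assocSwap-↑ʳ j = trans (cong (to inner) (assoc-↑ʳ a c b j))
    (trans (to-⊕-↑ʳ idP (idP ∘ₚ symP c b) (c ↑ʳ j)) (cong (a ↑ʳ_) (symP-↑ʳ c b j)))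

-- For substituting into one factor of a Day representative [x , y , f]: G = g ∘ f sends the
-- variable i of that factor to the last place, and the other variables are renumbered by restricting G.
module HoleInLeftBlock {a′ c m} (k : ℕ) (i : Fin (suc a′)) (G : Perm (suc a′ + c) (m + 1))
                       (hole : to G (i ↑ˡ c) ≡ m ↑ʳ Fin.zero) where
  private
    K : Perm ((a′ + c) + 1) (m + 1)
    K = G ∘ₚ (flip (moveLast i) ⊕ idP {c}) ∘ₚ flip (exchange a′ 1 c)

    K-fixes-last : to K ((a′ + c) ↑ʳ Fin.zero) ≡ m ↑ʳ Fin.zero
    K-fixes-last = begin
      to G (to (flip (moveLast i) ⊕ idP) (from (exchange a′ 1 c) ((a′ + c) ↑ʳ Fin.zero)))
        ≡⟨ cong (to G ∘ to (flip (moveLast i) ⊕ idP)) (from-≡ (exchange a′ 1 c) (exchange-↑ʳ↑ˡ a′ 1 c Fin.zero)) ⟩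
      to G (to (flip (moveLast i) ⊕ idP) ((a′ ↑ʳ Fin.zero) ↑ˡ c))
        ≡⟨ cong (to G) (to-⊕-↑ˡ (flip (moveLast i)) idP (a′ ↑ʳ Fin.zero)) ⟩
      to G (from (moveLast i) (a′ ↑ʳ Fin.zero) ↑ˡ c)  ≡⟨ cong (to G ∘ (_↑ˡ c)) (from-≡ (moveLast i) (moveLast-moves i)) ⟩
      to G (i ↑ˡ c)                                   ≡⟨ hole ⟩
      m ↑ʳ Fin.zero                                   ∎
      where open ≡-Reasoning

    K-left : ∀ j → to K ((j ↑ˡ c) ↑ˡ 1) ≡ to G (from (moveLast i) (j ↑ˡ 1) ↑ˡ c)
    K-left j = trans (cong (to G ∘ to (flip (moveLast i) ⊕ idP)) (from-≡ (exchange a′ 1 c) (exchange-↑ˡ a′ 1 c j)))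
                     (cong (to G) (to-⊕-↑ˡ (flip (moveLast i)) idP (j ↑ˡ 1)))

    K-right : ∀ j → to K ((a′ ↑ʳ j) ↑ˡ 1) ≡ to G (suc a′ ↑ʳ j)
    K-right j = trans (cong (to G ∘ to (flip (moveLast i) ⊕ idP)) (from-≡ (exchange a′ 1 c) (exchange-↑ʳ a′ 1 c j)))
                      (cong (to G) (to-⊕-↑ʳ (flip (moveLast i)) idP j))

    rest : Perm (a′ + c) m
    rest = restrictLast K K-fixes-last

  leftRenaming : Fin a′ → Fin m
  leftRenaming = to rest ∘ (_↑ˡ c)

  rightRenaming : Fin c → Fin m
  rightRenaming = to rest ∘ (a′ ↑ʳ_)

  newPerm : Perm ((a′ + k) + c) (m + k)
  newPerm = sendBack {a′} {c} k rest

  newPerm-left : to newPerm ∘ (_↑ˡ c) ≗ extend k leftRenaming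
  newPerm-left = extend-unique k leftRenaming (sendBack-↑ˡ {a′} {c} k rest) (sendBack-↑ʳ↑ˡ {a′} {c} k rest)

  newPerm-right : ∀ j → to newPerm ((a′ + k) ↑ʳ j) ≡ rightRenaming j ↑ˡ k
  newPerm-right = sendBack-↑ʳ {a′} {c} k rest

  G-right : ∀ j → to G (suc a′ ↑ʳ j) ≡ rightRenaming j ↑ˡ 1
  G-right j = trans (sym (K-right j)) (restrictLast-↑ˡ K K-fixes-last (a′ ↑ʳ j))

  G-left : liftRen₁ leftRenaming ∘ to (moveLast i) ≗ to G ∘ (_↑ˡ c)
  G-left j with split a′ 1 (to (moveLast i) j)
  ... | left j′ eq = begin
    liftRen₁ leftRenaming (to (moveLast i) j)       ≡⟨ cong (liftRen₁ leftRenaming) eq ⟩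
    liftRen₁ leftRenaming (j′ ↑ˡ 1)                 ≡⟨ liftRen₁-↑ˡ leftRenaming j′ ⟩
    to rest (j′ ↑ˡ c) ↑ˡ 1                          ≡⟨ restrictLast-↑ˡ K K-fixes-last (j′ ↑ˡ c) ⟨
    to K ((j′ ↑ˡ c) ↑ˡ 1)                           ≡⟨ K-left j′ ⟩
    to G (from (moveLast i) (j′ ↑ˡ 1) ↑ˡ c)         ≡⟨ cong (to G ∘ (_↑ˡ c)) (from-≡ (moveLast i) eq) ⟩
    to G (j ↑ˡ c)                                   ∎
    where open ≡-Reasoning
  ... | right z eq = begin
    liftRen₁ leftRenaming (to (moveLast i) j)       ≡⟨ cong (liftRen₁ leftRenaming) eq ⟩
    liftRen₁ leftRenaming (a′ ↑ʳ z)                 ≡⟨ liftRen₁-↑ʳ leftRenaming z ⟩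
    m ↑ʳ z                                          ≡⟨ cong (m ↑ʳ_) (Fin1-zero z) ⟩
    m ↑ʳ Fin.zero                                   ≡⟨ hole ⟨
    to G (i ↑ˡ c)                                   ≡⟨ cong (to G ∘ (_↑ˡ c)) j≡i ⟨
    to G (j ↑ˡ c)                                   ∎
    where
    open ≡-Reasoning
    j≡i : j ≡ i
    j≡i = to-injective (moveLast i) (trans eq (trans (cong (a′ ↑ʳ_) (Fin1-zero z)) (sym (moveLast-moves i))))

module HoleInRightBlock {a c′ m} (k : ℕ) (j : Fin (suc c′)) (G : Perm (a + suc c′) (m + 1))
                        (hole : to G (a ↑ʳ j) ≡ m ↑ʳ Fin.zero) where
  private
    K : Perm ((a + c′) + 1) (m + 1)
    K = G ∘ₚ (idP {a} ⊕ flip (moveLast j)) ∘ₚ castP (+-assoc a c′ 1)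

    K-fixes-last : to K ((a + c′) ↑ʳ Fin.zero) ≡ m ↑ʳ Fin.zero
    K-fixes-last = begin
      to G (to (idP ⊕ flip (moveLast j)) (to (castP (+-assoc a c′ 1)) ((a + c′) ↑ʳ Fin.zero)))
        ≡⟨ cong (to G ∘ to (idP ⊕ flip (moveLast j))) (assoc-↑ʳ a c′ 1 Fin.zero) ⟩
      to G (to (idP ⊕ flip (moveLast j)) (a ↑ʳ (c′ ↑ʳ Fin.zero)))
        ≡⟨ cong (to G) (to-⊕-↑ʳ idP (flip (moveLast j)) (c′ ↑ʳ Fin.zero)) ⟩
      to G (a ↑ʳ from (moveLast j) (c′ ↑ʳ Fin.zero))  ≡⟨ cong (to G ∘ (a ↑ʳ_)) (from-≡ (moveLast j) (moveLast-moves j)) ⟩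
      to G (a ↑ʳ j)                                   ≡⟨ hole ⟩
      m ↑ʳ Fin.zero                                   ∎
      where open ≡-Reasoning

    K-left : ∀ i → to K ((i ↑ˡ c′) ↑ˡ 1) ≡ to G (i ↑ˡ suc c′)
    K-left i = trans (cong (to G ∘ to (idP ⊕ flip (moveLast j))) (assoc-↑ˡ a c′ 1 i))
                     (cong (to G) (to-⊕-↑ˡ idP (flip (moveLast j)) i))

    K-right : ∀ j′ → to K ((a ↑ʳ j′) ↑ˡ 1) ≡ to G (a ↑ʳ from (moveLast j) (j′ ↑ˡ 1))
    K-right j′ = trans (cong (to G ∘ to (idP ⊕ flip (moveLast j))) (assoc-↑ʳ↑ˡ a c′ 1 j′))
                       (cong (to G) (to-⊕-↑ʳ idP (flip (moveLast j)) (j′ ↑ˡ 1)))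

    rest : Perm (a + c′) m
    rest = restrictLast K K-fixes-last

  leftRenaming : Fin a → Fin m
  leftRenaming = to rest ∘ (_↑ˡ c′)

  rightRenaming : Fin c′ → Fin m
  rightRenaming = to rest ∘ (a ↑ʳ_)

  newPerm : Perm (a + (c′ + k)) (m + k)
  newPerm = reassoc {a} {c′} k rest

  newPerm-left : ∀ i → to newPerm (i ↑ˡ (c′ + k)) ≡ leftRenaming i ↑ˡ k
  newPerm-left = reassoc-↑ˡ {a} {c′} k rest

  newPerm-right : to newPerm ∘ (a ↑ʳ_) ≗ extend k rightRenaming
  newPerm-right = extend-unique k rightRenaming (reassoc-↑ʳ↑ˡ {a} {c′} k rest) (reassoc-↑ʳ↑ʳ {a} {c′} k rest)

  G-left : ∀ i → to G (i ↑ˡ suc c′) ≡ leftRenaming i ↑ˡ 1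
  G-left i = trans (sym (K-left i)) (restrictLast-↑ˡ K K-fixes-last (i ↑ˡ c′))

  G-right : liftRen₁ rightRenaming ∘ to (moveLast j) ≗ to G ∘ (a ↑ʳ_)
  G-right j₀ with split c′ 1 (to (moveLast j) j₀)
  ... | left j′ eq = begin
    liftRen₁ rightRenaming (to (moveLast j) j₀)     ≡⟨ cong (liftRen₁ rightRenaming) eq ⟩
    liftRen₁ rightRenaming (j′ ↑ˡ 1)                ≡⟨ liftRen₁-↑ˡ rightRenaming j′ ⟩
    to rest (a ↑ʳ j′) ↑ˡ 1                          ≡⟨ restrictLast-↑ˡ K K-fixes-last (a ↑ʳ j′) ⟨
    to K ((a ↑ʳ j′) ↑ˡ 1)                           ≡⟨ K-right j′ ⟩
    to G (a ↑ʳ from (moveLast j) (j′ ↑ˡ 1))         ≡⟨ cong (to G ∘ (a ↑ʳ_)) (from-≡ (moveLast j) eq) ⟩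
    to G (a ↑ʳ j₀)                                  ∎
    where open ≡-Reasoning
  ... | right z eq = begin
    liftRen₁ rightRenaming (to (moveLast j) j₀)     ≡⟨ cong (liftRen₁ rightRenaming) eq ⟩
    liftRen₁ rightRenaming (c′ ↑ʳ z)                ≡⟨ liftRen₁-↑ʳ rightRenaming z ⟩
    m ↑ʳ z                                          ≡⟨ cong (m ↑ʳ_) (Fin1-zero z) ⟩
    m ↑ʳ Fin.zero                                   ≡⟨ hole ⟨
    to G (a ↑ʳ j)                                   ≡⟨ cong (to G ∘ (a ↑ʳ_)) j₀≡j ⟨
    to G (a ↑ʳ j₀)                                  ∎
    where
    open ≡-Reasoning
    j₀≡j : j₀ ≡ j
    j₀≡j = to-injective (moveLast j) (trans eq (trans (cong (c′ ↑ʳ_) (Fin1-zero z)) (sym (moveLast-moves j))))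

module _ {X : Species} {n : ℕ} where
  open Setoid (obj X n) public
    using () renaming (refl to ≈-refl; sym to ≈-sym; trans to ≈-trans; reflexive to ≈-reflexive)

liftPerm : ∀ k {a b} → Perm a b → Perm (a ⊹ k) (b ⊹ k)
liftPerm zero g = g
liftPerm (suc k) g = liftPerm k (g ⊕ idP {1})

to-liftPerm : ∀ k {a b} (g : Perm a b) → to (liftPerm k g) ≗ liftRen k (to g)
to-liftPerm zero g i = refl
to-liftPerm (suc k) g i = to-liftPerm k (g ⊕ idP {1}) i

module _ (X : Species) where
  unfoldδ : ∀ k {a} → El (δ^ k X) a → El X (a ⊹ k)
  unfoldδ zero x = x
  unfoldδ (suc k) x = unfoldδ k x

  foldδ : ∀ k {a} → El X (a ⊹ k) → El (δ^ k X) a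
  foldδ zero x = x
  foldδ (suc k) x = foldδ k x

  unfoldδ-foldδ : ∀ k {a} (x : El X (a ⊹ k)) → unfoldδ k {a} (foldδ k x) ≡ x
  unfoldδ-foldδ zero x = refl
  unfoldδ-foldδ (suc k) x = unfoldδ-foldδ k x

  unfoldδ-≈ : ∀ k {a x y} → Eq (δ^ k X) a x y → Eq X (a ⊹ k) (unfoldδ k x) (unfoldδ k y)
  unfoldδ-≈ zero eq = eq
  unfoldδ-≈ (suc k) eq = unfoldδ-≈ k eq

  unfoldδ-≈⁻ : ∀ k {a x y} → Eq X (a ⊹ k) (unfoldδ k x) (unfoldδ k y) → Eq (δ^ k X) a x y
  unfoldδ-≈⁻ zero eq = eq
  unfoldδ-≈⁻ (suc k) eq = unfoldδ-≈⁻ k eq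

  unfoldδ-act : ∀ k {a b} (g : Perm a b) (x : El (δ^ k X) a) →
                unfoldδ k (act (δ^ k X) g x) ≡ act X (liftPerm k g) (unfoldδ k x)
  unfoldδ-act zero g x = refl
  unfoldδ-act (suc k) g x = unfoldδ-act k (g ⊕ idP {1}) x

unfoldδ-map : ∀ k {A B : Species} (h : ∀ {m} → El A m → El B m) {a} (x : El (δ^ k A) a) →
              unfoldδ B k (δ^-map k h x) ≡ h (unfoldδ A k x)
unfoldδ-map zero h x = refl
unfoldδ-map (suc k) h x = unfoldδ-map k h x

module _ {A B : Species} (h : Hom A B) where
  δ^-map-cong : ∀ k {a} {x y : El (δ^ k A) a} → Eq (δ^ k A) a x y →
                Eq (δ^ k B) a (δ^-map k (fun h) x) (δ^-map k (fun h) y)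
  δ^-map-cong zero eq = fun-cong h eq
  δ^-map-cong (suc k) eq = δ^-map-cong k eq

  δ^-map-natural : ∀ k {a b} (g : Perm a b) (x : El (δ^ k A) a) →
                   Eq (δ^ k B) b (δ^-map k (fun h) (act (δ^ k A) g x)) (act (δ^ k B) g (δ^-map k (fun h) x))
  δ^-map-natural zero g x = natural h g x
  δ^-map-natural (suc k) g x = δ^-map-natural k (g ⊕ idP {1}) x

  mutual
    prodL-map-cong : ∀ ks {b} {e e′ : El (prodL ks A) b} → Eq (prodL ks A) b e e′ →
                     Eq (prodL ks B) b (prodL-map ks (fun h) e) (prodL-map ks (fun h) e′)
    prodL-map-cong [] eq = eq
    prodL-map-cong (k ∷ []) eq = δ^-map-cong k eq
    prodL-map-cong (k ∷ l ∷ ks) eq = closure eq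
      where
      step : ∀ {b} {e e′ : DayEl (δ^ k A) (prodL (l ∷ ks) A) b} → DayR _ _ e e′ →
             DayR (δ^ k B) (prodL (l ∷ ks) B) (prodL-map (k ∷ l ∷ ks) (fun h) e) (prodL-map (k ∷ l ∷ ks) (fun h) e′)
      step (gen α β x≈ y≈ f≗) =
        gen α β (≈-trans {δ^ k B} (≈-sym {δ^ k B} (δ^-map-natural k α _)) (δ^-map-cong k x≈))
                (≈-trans {prodL (l ∷ ks) B} (≈-sym {prodL (l ∷ ks) B} (prodL-map-natural (l ∷ ks) β _)) (prodL-map-cong (l ∷ ks) y≈))
                f≗
      closure : ∀ {b} {e e′ : DayEl (δ^ k A) (prodL (l ∷ ks) A) b} → EqClosure (DayR _ _) e e′ →
                EqClosure (DayR (δ^ k B) (prodL (l ∷ ks) B)) (prodL-map (k ∷ l ∷ ks) (fun h) e) (prodL-map (k ∷ l ∷ ks) (fun h) e′)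
      closure ε = ε
      closure (fwd r ◅ rs) = fwd (step r) ◅ closure rs
      closure (bwd r ◅ rs) = bwd (step r) ◅ closure rs

    prodL-map-natural : ∀ ks {a b} (g : Perm a b) (e : El (prodL ks A) a) →
                        Eq (prodL ks B) b (prodL-map ks (fun h) (act (prodL ks A) g e)) (act (prodL ks B) g (prodL-map ks (fun h) e))
    prodL-map-natural [] g e _ = refl
    prodL-map-natural (k ∷ []) g e = δ^-map-natural k g e
    prodL-map-natural (k ∷ l ∷ ks) g (day x y f) = ≈-refl {prodL (k ∷ l ∷ ks) B}

  ΣF-map-cong : ∀ S {n} {e e′ : El (ΣF S A) n} → Eq (ΣF S A) n e e′ → Eq (ΣF S B) n (ΣF-map S (fun h) e) (ΣF-map S (fun h) e′)
  ΣF-map-cong S (inj≈ eq) = inj≈ (prodL-map-cong (arity S _) eq)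

  ΣF-map-natural : ∀ S {a b} (g : Perm a b) (e : El (ΣF S A) a) →
                   Eq (ΣF S B) b (ΣF-map S (fun h) (act (ΣF S A) g e)) (act (ΣF S B) g (ΣF-map S (fun h) e))
  ΣF-map-natural S g (ω , e) = inj≈ (prodL-map-natural (arity S ω) g e)

δ^-map-∘ : ∀ k {A B C : Species} (g : ∀ {m} → El B m → El C m) (h : ∀ {m} → El A m → El B m) {a} (x : El (δ^ k A) a) →
           δ^-map k {B} {C} g (δ^-map k {A} {B} h x) ≡ δ^-map k {A} {C} (g ∘ h) x
δ^-map-∘ zero g h x = refl
δ^-map-∘ (suc k) {A} {B} {C} g h x = δ^-map-∘ k {A} {B} {C} g h x

δ^-map-id : ∀ k {A : Species} {a} (x : El (δ^ k A) a) → δ^-map k {A} {A} (λ z → z) x ≡ x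
δ^-map-id zero x = refl
δ^-map-id (suc k) {A} x = δ^-map-id k {A} x

prodL-map-∘ : ∀ ks {A B C : Species} (g : ∀ {m} → El B m → El C m) (h : ∀ {m} → El A m → El B m) {a} (e : El (prodL ks A) a) →
              prodL-map ks {B} {C} g (prodL-map ks {A} {B} h e) ≡ prodL-map ks {A} {C} (g ∘ h) e
prodL-map-∘ [] g h e = refl
prodL-map-∘ (k ∷ []) {A} {B} {C} g h e = δ^-map-∘ k {A} {B} {C} g h e
prodL-map-∘ (k ∷ l ∷ ks) {A} {B} {C} g h (day x y f) =
  cong₂ (λ u v → day u v f) (δ^-map-∘ k {A} {B} {C} g h x) (prodL-map-∘ (l ∷ ks) {A} {B} {C} g h y)

prodL-map-id : ∀ ks {A : Species} {a} (e : El (prodL ks A) a) → prodL-map ks {A} {A} (λ z → z) e ≡ e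
prodL-map-id [] e = refl
prodL-map-id (k ∷ []) {A} e = δ^-map-id k {A} e
prodL-map-id (k ∷ l ∷ ks) {A} (day x y f) = cong₂ (λ u v → day u v f) (δ^-map-id k {A} x) (prodL-map-id (l ∷ ks) {A} y)

-- Raw syntax

module Syntax (S : BindingSig) where

  mutual
    data Tm (n : ℕ) : Set where
      var : Fin n → Tm n
      op  : (ω : Op S) → Args n (arity S ω) → Tm n

    data Args (n : ℕ) : List ℕ → Set where
      []  : Args n []
      _∷_ : ∀ {k ks} → Tm (n ⊹ k) → Args n ks → Args n (k ∷ ks)

  var-injective : ∀ {n} {i j : Fin n} → var i ≡ var j → i ≡ j
  var-injective refl = refl

  op-injectiveˡ : ∀ {n ω ω′} {as : Args n (arity S ω)} {as′ : Args n (arity S ω′)} → op ω as ≡ op ω′ as′ → ω ≡ ω′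
  op-injectiveˡ refl = refl

  op-injectiveʳ : ∀ {n ω} {as as′ : Args n (arity S ω)} → op ω as ≡ op ω as′ → as ≡ as′
  op-injectiveʳ refl = refl

  ∷-injective : ∀ {n k ks} {t t′ : Tm (n ⊹ k)} {as as′ : Args n ks} →
                _≡_ {A = Args n (k ∷ ks)} (t ∷ as) (t′ ∷ as′) → t ≡ t′ × as ≡ as′
  ∷-injective refl = refl , refl

  mutual
    rename : ∀ {n m} → (Fin n → Fin m) → Tm n → Tm m
    rename ρ (var i) = var (ρ i)
    rename ρ (op ω as) = op ω (renameArgs ρ as)

    renameArgs : ∀ {n m ks} → (Fin n → Fin m) → Args n ks → Args m ks
    renameArgs ρ [] = []
    renameArgs ρ (_∷_ {k} t as) = rename (liftRen k ρ) t ∷ renameArgs ρ as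

  mutual
    rename-cong : ∀ {n m} {ρ ρ′ : Fin n → Fin m} → ρ ≗ ρ′ → rename ρ ≗ rename ρ′
    rename-cong eq (var i) = cong var (eq i)
    rename-cong eq (op ω as) = cong (op ω) (renameArgs-cong eq as)

    renameArgs-cong : ∀ {n m ks} {ρ ρ′ : Fin n → Fin m} → ρ ≗ ρ′ → renameArgs {ks = ks} ρ ≗ renameArgs ρ′
    renameArgs-cong eq [] = refl
    renameArgs-cong eq (_∷_ {k} t as) = cong₂ _∷_ (rename-cong (liftRen-cong k eq) t) (renameArgs-cong eq as)

  mutual
    rename-id : ∀ {n} {ρ : Fin n → Fin n} → ρ ≗ (λ i → i) → ∀ t → rename ρ t ≡ t
    rename-id eq (var i) = cong var (eq i)
    rename-id eq (op ω as) = cong (op ω) (renameArgs-id eq as)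

    renameArgs-id : ∀ {n ks} {ρ : Fin n → Fin n} → ρ ≗ (λ i → i) → ∀ (as : Args n ks) → renameArgs ρ as ≡ as
    renameArgs-id eq [] = refl
    renameArgs-id eq (_∷_ {k} t as) =
      cong₂ _∷_ (rename-id (λ i → trans (liftRen-cong k eq i) (liftRen-id k i)) t) (renameArgs-id eq as)

  mutual
    rename-∘ : ∀ {n m o} (ρ : Fin m → Fin o) (τ : Fin n → Fin m) t → rename ρ (rename τ t) ≡ rename (ρ ∘ τ) t
    rename-∘ ρ τ (var i) = refl
    rename-∘ ρ τ (op ω as) = cong (op ω) (renameArgs-∘ ρ τ as)

    renameArgs-∘ : ∀ {n m o ks} (ρ : Fin m → Fin o) (τ : Fin n → Fin m) (as : Args n ks) →
                   renameArgs ρ (renameArgs τ as) ≡ renameArgs (ρ ∘ τ) as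
    renameArgs-∘ ρ τ [] = refl
    renameArgs-∘ ρ τ (_∷_ {k} t as) =
      cong₂ _∷_ (trans (rename-∘ (liftRen k ρ) (liftRen k τ) t) (rename-cong (λ i → sym (liftRen-∘ k ρ τ i)) t))
                (renameArgs-∘ ρ τ as)

  rename-∘≗ : ∀ {n m o} {ρ : Fin m → Fin o} {τ : Fin n → Fin m} {μ : Fin n → Fin o} →
              ρ ∘ τ ≗ μ → ∀ t → rename ρ (rename τ t) ≡ rename μ t
  rename-∘≗ {ρ = ρ} {τ} eq t = trans (rename-∘ ρ τ t) (rename-cong eq t)

  mutual
    rename-injective : ∀ {n m} {ρ : Fin n → Fin m} → Injective _≡_ _≡_ ρ → ∀ t t′ → rename ρ t ≡ rename ρ t′ → t ≡ t′
    rename-injective inj (var i) (var j) eq = cong var (inj (var-injective eq))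
    rename-injective {ρ = ρ} inj (op ω as) (op ω′ as′) eq with op-injectiveˡ {as = renameArgs ρ as} {as′ = renameArgs ρ as′} eq
    ... | refl = cong (op ω) (renameArgs-injective inj as as′ (op-injectiveʳ eq))

    renameArgs-injective : ∀ {n m ks} {ρ : Fin n → Fin m} → Injective _≡_ _≡_ ρ →
                           ∀ (as as′ : Args n ks) → renameArgs ρ as ≡ renameArgs ρ as′ → as ≡ as′
    renameArgs-injective inj [] [] eq = refl
    renameArgs-injective inj (_∷_ {k} t as) (t′ ∷ as′) eq =
      cong₂ _∷_ (rename-injective (liftRen-injective k inj) t t′ (proj₁ (∷-injective eq)))
                (renameArgs-injective inj as as′ (proj₂ (∷-injective eq)))

  mutual
    data Occurs {n} (ℓ : Fin n) : Tm n → Set where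
      here : Occurs ℓ (var ℓ)
      inOp : ∀ {ω as} → OccursArgs ℓ as → Occurs ℓ (op ω as)

    data OccursArgs {n} (ℓ : Fin n) : ∀ {ks} → Args n ks → Set where
      head : ∀ {k ks t} {as : Args n ks} → Occurs (weaken k ℓ) t → OccursArgs ℓ (_∷_ {k = k} t as)
      tail : ∀ {k ks t} {as : Args n ks} → OccursArgs ℓ as → OccursArgs ℓ (_∷_ {k = k} t as)

  mutual
    occurs-rename : ∀ {n m} (ρ : Fin n → Fin m) {ℓ t} → Occurs ℓ t → Occurs (ρ ℓ) (rename ρ t)
    occurs-rename ρ here = here
    occurs-rename ρ (inOp o) = inOp (occursArgs-rename ρ o)

    occursArgs-rename : ∀ {n m ks} (ρ : Fin n → Fin m) {ℓ} {as : Args n ks} → OccursArgs ℓ as → OccursArgs (ρ ℓ) (renameArgs ρ as)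
    occursArgs-rename ρ {ℓ} (head {k} o) = head (subst (λ z → Occurs z _) (liftRen-weaken k ρ ℓ) (occurs-rename (liftRen k ρ) o))
    occursArgs-rename ρ (tail o) = tail (occursArgs-rename ρ o)

  mutual
    occurs-rename⁻ : ∀ {n m} (ρ : Fin n → Fin m) {ℓ′} t → Occurs ℓ′ (rename ρ t) → Σ[ ℓ ∈ Fin n ] ρ ℓ ≡ ℓ′
    occurs-rename⁻ ρ (var i) here = i , refl
    occurs-rename⁻ ρ (op ω as) (inOp o) = occursArgs-rename⁻ ρ as o

    occursArgs-rename⁻ : ∀ {n m ks} (ρ : Fin n → Fin m) {ℓ′} (as : Args n ks) →
                         OccursArgs ℓ′ (renameArgs ρ as) → Σ[ ℓ ∈ Fin n ] ρ ℓ ≡ ℓ′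
    occursArgs-rename⁻ ρ {ℓ′} (_∷_ {k} t as) (head o) with occurs-rename⁻ (liftRen k ρ) t o
    ... | j , eq with liftRen-weaken⁻ k ρ j ℓ′ eq
    ...   | i , _ , ρi≡ℓ′ = i , ρi≡ℓ′
    occursArgs-rename⁻ ρ (t ∷ as) (tail o) = occursArgs-rename⁻ ρ as o

  liftSub₁ : ∀ {n m} → (Fin n → Tm m) → Fin (n + 1) → Tm (m + 1)
  liftSub₁ {n} {m} σ i = Sum.[ (λ j → rename (_↑ˡ 1) (σ j)) , (λ z → var (m ↑ʳ z)) ] (splitAt n i)

  liftSub : ∀ k {n m} → (Fin n → Tm m) → Fin (n ⊹ k) → Tm (m ⊹ k)
  liftSub zero σ = σ
  liftSub (suc k) σ = liftSub k (liftSub₁ σ)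

  mutual
    sub : ∀ {n m} → (Fin n → Tm m) → Tm n → Tm m
    sub σ (var i) = σ i
    sub σ (op ω as) = op ω (subArgs σ as)

    subArgs : ∀ {n m ks} → (Fin n → Tm m) → Args n ks → Args m ks
    subArgs σ [] = []
    subArgs σ (_∷_ {k} t as) = sub (liftSub k σ) t ∷ subArgs σ as

  liftSub₁-↑ˡ : ∀ {n m} (σ : Fin n → Tm m) i → liftSub₁ σ (i ↑ˡ 1) ≡ rename (_↑ˡ 1) (σ i)
  liftSub₁-↑ˡ {n} σ i rewrite splitAt-↑ˡ n i 1 = refl

  liftSub₁-↑ʳ : ∀ {n m} (σ : Fin n → Tm m) z → liftSub₁ σ (n ↑ʳ z) ≡ var (m ↑ʳ z)
  liftSub₁-↑ʳ {n} σ z rewrite splitAt-↑ʳ n 1 z = refl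

  liftSub₁-cong : ∀ {n m} {σ σ′ : Fin n → Tm m} → σ ≗ σ′ → liftSub₁ σ ≗ liftSub₁ σ′
  liftSub₁-cong {n} {σ = σ} {σ′} eq i with split n 1 i
  ... | left j refl = trans (liftSub₁-↑ˡ σ j) (trans (cong (rename (_↑ˡ 1)) (eq j)) (sym (liftSub₁-↑ˡ σ′ j)))
  ... | right z refl = trans (liftSub₁-↑ʳ σ z) (sym (liftSub₁-↑ʳ σ′ z))

  liftSub-cong : ∀ k {n m} {σ σ′ : Fin n → Tm m} → σ ≗ σ′ → liftSub k σ ≗ liftSub k σ′
  liftSub-cong zero eq = eq
  liftSub-cong (suc k) eq = liftSub-cong k (liftSub₁-cong eq)

  mutual
    sub-cong : ∀ {n m} {σ σ′ : Fin n → Tm m} → σ ≗ σ′ → sub σ ≗ sub σ′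
    sub-cong eq (var i) = eq i
    sub-cong eq (op ω as) = cong (op ω) (subArgs-cong eq as)

    subArgs-cong : ∀ {n m ks} {σ σ′ : Fin n → Tm m} → σ ≗ σ′ → subArgs {ks = ks} σ ≗ subArgs σ′
    subArgs-cong eq [] = refl
    subArgs-cong eq (_∷_ {k} t as) = cong₂ _∷_ (sub-cong (liftSub-cong k eq) t) (subArgs-cong eq as)

  liftSub-var : ∀ k {n m} {σ : Fin n → Tm m} {ρ : Fin n → Fin m} → σ ≗ var ∘ ρ → liftSub k σ ≗ var ∘ liftRen k ρ
  liftSub-var zero eq = eq
  liftSub-var (suc k) {n} {m} {σ} {ρ} eq = liftSub-var k lift₁
    where
    lift₁ : liftSub₁ σ ≗ var ∘ liftRen₁ ρ
    lift₁ i with split n 1 i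
    ... | left j refl = trans (liftSub₁-↑ˡ σ j) (trans (cong (rename (_↑ˡ 1)) (eq j)) (cong var (sym (liftRen₁-↑ˡ ρ j))))
    ... | right z refl = trans (liftSub₁-↑ʳ σ z) (cong var (sym (liftRen₁-↑ʳ ρ z)))

  mutual
    sub-var : ∀ {n m} {σ : Fin n → Tm m} {ρ : Fin n → Fin m} → σ ≗ var ∘ ρ → sub σ ≗ rename ρ
    sub-var eq (var i) = eq i
    sub-var eq (op ω as) = cong (op ω) (subArgs-var eq as)

    subArgs-var : ∀ {n m ks} {σ : Fin n → Tm m} {ρ : Fin n → Fin m} → σ ≗ var ∘ ρ → subArgs {ks = ks} σ ≗ renameArgs ρ
    subArgs-var eq [] = refl
    subArgs-var eq (_∷_ {k} t as) = cong₂ _∷_ (sub-var (liftSub-var k eq) t) (subArgs-var eq as)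

  liftSub-rename : ∀ k {n m o} {ρ : Fin m → Fin o} {σ : Fin n → Tm m} {σ′ : Fin n → Tm o} →
                   rename ρ ∘ σ ≗ σ′ → rename (liftRen k ρ) ∘ liftSub k σ ≗ liftSub k σ′
  liftSub-rename zero eq = eq
  liftSub-rename (suc k) {n} {m} {o} {ρ} {σ} {σ′} eq = liftSub-rename k lift₁
    where
    lift₁ : rename (liftRen₁ ρ) ∘ liftSub₁ σ ≗ liftSub₁ σ′
    lift₁ i with split n 1 i
    ... | left j refl = begin
      rename (liftRen₁ ρ) (liftSub₁ σ (j ↑ˡ 1))      ≡⟨ cong (rename (liftRen₁ ρ)) (liftSub₁-↑ˡ σ j) ⟩
      rename (liftRen₁ ρ) (rename (_↑ˡ 1) (σ j))     ≡⟨ rename-∘≗ (liftRen₁-↑ˡ ρ) (σ j) ⟩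
      rename ((_↑ˡ 1) ∘ ρ) (σ j)                      ≡⟨ rename-∘ (_↑ˡ 1) ρ (σ j) ⟨
      rename (_↑ˡ 1) (rename ρ (σ j))                 ≡⟨ cong (rename (_↑ˡ 1)) (eq j) ⟩
      rename (_↑ˡ 1) (σ′ j)                           ≡⟨ liftSub₁-↑ˡ σ′ j ⟨
      liftSub₁ σ′ (j ↑ˡ 1)                            ∎
      where open ≡-Reasoning
    ... | right z refl =
      trans (cong (rename (liftRen₁ ρ)) (liftSub₁-↑ʳ σ z)) (trans (cong var (liftRen₁-↑ʳ ρ z)) (sym (liftSub₁-↑ʳ σ′ z)))

  mutual
    rename-sub : ∀ {n m o} {ρ : Fin m → Fin o} {σ : Fin n → Tm m} {σ′ : Fin n → Tm o} →
                 rename ρ ∘ σ ≗ σ′ → rename ρ ∘ sub σ ≗ sub σ′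
    rename-sub eq (var i) = eq i
    rename-sub eq (op ω as) = cong (op ω) (renameArgs-subArgs eq as)

    renameArgs-subArgs : ∀ {n m o ks} {ρ : Fin m → Fin o} {σ : Fin n → Tm m} {σ′ : Fin n → Tm o} →
                         rename ρ ∘ σ ≗ σ′ → renameArgs {ks = ks} ρ ∘ subArgs σ ≗ subArgs σ′
    renameArgs-subArgs eq [] = refl
    renameArgs-subArgs eq (_∷_ {k} t as) = cong₂ _∷_ (rename-sub (liftSub-rename k eq) t) (renameArgs-subArgs eq as)

  liftSub-liftRen : ∀ k {n m o} {σ : Fin m → Tm o} {ρ : Fin n → Fin m} {σ′ : Fin n → Tm o} →
                    σ ∘ ρ ≗ σ′ → liftSub k σ ∘ liftRen k ρ ≗ liftSub k σ′
  liftSub-liftRen zero eq = eq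
  liftSub-liftRen (suc k) {n} {m} {o} {σ} {ρ} {σ′} eq = liftSub-liftRen k lift₁
    where
    lift₁ : liftSub₁ σ ∘ liftRen₁ ρ ≗ liftSub₁ σ′
    lift₁ i with split n 1 i
    ... | left j refl = trans (cong (liftSub₁ σ) (liftRen₁-↑ˡ ρ j))
      (trans (liftSub₁-↑ˡ σ (ρ j)) (trans (cong (rename (_↑ˡ 1)) (eq j)) (sym (liftSub₁-↑ˡ σ′ j))))
    ... | right z refl = trans (cong (liftSub₁ σ) (liftRen₁-↑ʳ ρ z)) (trans (liftSub₁-↑ʳ σ z) (sym (liftSub₁-↑ʳ σ′ z)))

  mutual
    sub-rename : ∀ {n m o} {σ : Fin m → Tm o} {ρ : Fin n → Fin m} {σ′ : Fin n → Tm o} →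
                 σ ∘ ρ ≗ σ′ → sub σ ∘ rename ρ ≗ sub σ′
    sub-rename eq (var i) = eq i
    sub-rename eq (op ω as) = cong (op ω) (subArgs-renameArgs eq as)

    subArgs-renameArgs : ∀ {n m o ks} {σ : Fin m → Tm o} {ρ : Fin n → Fin m} {σ′ : Fin n → Tm o} →
                         σ ∘ ρ ≗ σ′ → subArgs {ks = ks} σ ∘ renameArgs ρ ≗ subArgs σ′
    subArgs-renameArgs eq [] = refl
    subArgs-renameArgs eq (_∷_ {k} t as) = cong₂ _∷_ (sub-rename (liftSub-liftRen k eq) t) (subArgs-renameArgs eq as)

  liftSub-sub : ∀ k {n m o} {σ₁ : Fin m → Tm o} {σ₂ : Fin n → Tm m} {σ′ : Fin n → Tm o} →
                sub σ₁ ∘ σ₂ ≗ σ′ → sub (liftSub k σ₁) ∘ liftSub k σ₂ ≗ liftSub k σ′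
  liftSub-sub zero eq = eq
  liftSub-sub (suc k) {n} {m} {o} {σ₁} {σ₂} {σ′} eq = liftSub-sub k lift₁
    where
    lift₁ : sub (liftSub₁ σ₁) ∘ liftSub₁ σ₂ ≗ liftSub₁ σ′
    lift₁ i with split n 1 i
    ... | left j refl = begin
      sub (liftSub₁ σ₁) (liftSub₁ σ₂ (j ↑ˡ 1))      ≡⟨ cong (sub (liftSub₁ σ₁)) (liftSub₁-↑ˡ σ₂ j) ⟩
      sub (liftSub₁ σ₁) (rename (_↑ˡ 1) (σ₂ j))     ≡⟨ sub-rename (liftSub₁-↑ˡ σ₁) (σ₂ j) ⟩
      sub (rename (_↑ˡ 1) ∘ σ₁) (σ₂ j)              ≡⟨ rename-sub (λ _ → refl) (σ₂ j) ⟨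
      rename (_↑ˡ 1) (sub σ₁ (σ₂ j))                ≡⟨ cong (rename (_↑ˡ 1)) (eq j) ⟩
      rename (_↑ˡ 1) (σ′ j)                         ≡⟨ liftSub₁-↑ˡ σ′ j ⟨
      liftSub₁ σ′ (j ↑ˡ 1)                          ∎
      where open ≡-Reasoning
    ... | right z refl =
      trans (cong (sub (liftSub₁ σ₁)) (liftSub₁-↑ʳ σ₂ z)) (trans (liftSub₁-↑ʳ σ₁ z) (sym (liftSub₁-↑ʳ σ′ z)))

  mutual
    sub-sub : ∀ {n m o} {σ₁ : Fin m → Tm o} {σ₂ : Fin n → Tm m} {σ′ : Fin n → Tm o} →
              sub σ₁ ∘ σ₂ ≗ σ′ → sub σ₁ ∘ sub σ₂ ≗ sub σ′
    sub-sub eq (var i) = eq i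
    sub-sub eq (op ω as) = cong (op ω) (subArgs-subArgs eq as)

    subArgs-subArgs : ∀ {n m o ks} {σ₁ : Fin m → Tm o} {σ₂ : Fin n → Tm m} {σ′ : Fin n → Tm o} →
                      sub σ₁ ∘ σ₂ ≗ σ′ → subArgs {ks = ks} σ₁ ∘ subArgs σ₂ ≗ subArgs σ′
    subArgs-subArgs eq [] = refl
    subArgs-subArgs eq (_∷_ {k} t as) = cong₂ _∷_ (sub-sub (liftSub-sub k eq) t) (subArgs-subArgs eq as)

  substLast : ∀ {m k} → Tm k → Fin (m + 1) → Tm (m + k)
  substLast {m} {k} u i = Sum.[ (λ j → var (j ↑ˡ k)) , (λ _ → rename (m ↑ʳ_) u) ] (splitAt m i)

  substLast-↑ˡ : ∀ {m k} (u : Tm k) (j : Fin m) → substLast {m} u (j ↑ˡ 1) ≡ var (j ↑ˡ k)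
  substLast-↑ˡ {m} u j rewrite splitAt-↑ˡ m j 1 = refl

  substLast-↑ʳ : ∀ {m k} (u : Tm k) z → substLast {m} u (m ↑ʳ z) ≡ rename (m ↑ʳ_) u
  substLast-↑ʳ {m} u z rewrite splitAt-↑ʳ m 1 z = refl

  substLast-extend : ∀ {a n k} (u : Tm k) (ρ : Fin a → Fin n) → rename (extend k ρ) ∘ substLast u ≗ substLast u ∘ liftRen₁ ρ
  substLast-extend {a} {n} {k} u ρ w with split a 1 w
  ... | left j refl = begin
    rename (extend k ρ) (substLast u (j ↑ˡ 1))  ≡⟨ cong (rename (extend k ρ)) (substLast-↑ˡ u j) ⟩
    var (extend k ρ (j ↑ˡ k))                   ≡⟨ cong var (extend-↑ˡ k ρ j) ⟩
    var (ρ j ↑ˡ k)                              ≡⟨ substLast-↑ˡ u (ρ j) ⟨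
    substLast u (ρ j ↑ˡ 1)                      ≡⟨ cong (substLast u) (liftRen₁-↑ˡ ρ j) ⟨
    substLast u (liftRen₁ ρ (j ↑ˡ 1))           ∎
    where open ≡-Reasoning
  ... | right z refl = begin
    rename (extend k ρ) (substLast u (a ↑ʳ z))  ≡⟨ cong (rename (extend k ρ)) (substLast-↑ʳ u z) ⟩
    rename (extend k ρ) (rename (a ↑ʳ_) u)      ≡⟨ rename-∘≗ (extend-↑ʳ k ρ) u ⟩
    rename (n ↑ʳ_) u                            ≡⟨ substLast-↑ʳ u z ⟨
    substLast u (n ↑ʳ z)                        ≡⟨ cong (substLast u) (liftRen₁-↑ʳ ρ z) ⟨
    substLast u (liftRen₁ ρ (a ↑ʳ z))           ∎
    where open ≡-Reasoning

  substLast-⊕ : ∀ {m m′ k k′} (α : Perm m m′) (β : Perm k k′) (u : Tm k) →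
                substLast (rename (to β) u) ∘ to (α ⊕ idP {1}) ≗ rename (to (α ⊕ β)) ∘ substLast u
  substLast-⊕ {m} {m′} {k} {k′} α β u i with split m 1 i
  ... | left j refl = begin
    substLast (rename (to β) u) (to (α ⊕ idP) (j ↑ˡ 1))  ≡⟨ cong (substLast _) (to-⊕-↑ˡ α idP j) ⟩
    substLast (rename (to β) u) (to α j ↑ˡ 1)            ≡⟨ substLast-↑ˡ _ (to α j) ⟩
    var (to α j ↑ˡ k′)                                   ≡⟨ cong var (to-⊕-↑ˡ α β j) ⟨
    var (to (α ⊕ β) (j ↑ˡ k))                            ≡⟨ cong (rename (to (α ⊕ β))) (substLast-↑ˡ u j) ⟨
    rename (to (α ⊕ β)) (substLast u (j ↑ˡ 1))           ∎
    where open ≡-Reasoning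
  ... | right z refl = begin
    substLast (rename (to β) u) (to (α ⊕ idP) (m ↑ʳ z))  ≡⟨ cong (substLast _) (to-⊕-↑ʳ α idP z) ⟩
    substLast (rename (to β) u) (m′ ↑ʳ z)                ≡⟨ substLast-↑ʳ _ z ⟩
    rename (m′ ↑ʳ_) (rename (to β) u)                    ≡⟨ rename-∘≗ (λ w → sym (to-⊕-↑ʳ α β w)) u ⟩
    rename (to (α ⊕ β) ∘ (m ↑ʳ_)) u                      ≡⟨ rename-∘ (to (α ⊕ β)) (m ↑ʳ_) u ⟨
    rename (to (α ⊕ β)) (rename (m ↑ʳ_) u)               ≡⟨ cong (rename (to (α ⊕ β))) (substLast-↑ʳ u z) ⟨
    rename (to (α ⊕ β)) (substLast u (m ↑ʳ z))           ∎
    where open ≡-Reasoning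

  rename-sub-commute : ∀ k {a b c d} {ρ : Fin b → Fin d} {σ₁ : Fin a → Tm b} {σ₂ : Fin c → Tm d} {τ : Fin a → Fin c} →
                       rename ρ ∘ σ₁ ≗ σ₂ ∘ τ →
                       ∀ t → rename (liftRen k ρ) (sub (liftSub k σ₁) t) ≡ sub (liftSub k σ₂) (rename (liftRen k τ) t)
  rename-sub-commute k eq t = trans (rename-sub (liftSub-rename k (λ _ → refl)) t)
    (trans (sub-cong (liftSub-cong k eq) t) (sym (sub-rename (liftSub-liftRen k (λ _ → refl)) t)))

  sub-liftRen-var : ∀ k {a b c} {σ : Fin b → Tm c} {τ : Fin a → Fin b} {ρ : Fin a → Fin c} → σ ∘ τ ≗ var ∘ ρ →
                    ∀ t → sub (liftSub k σ) (rename (liftRen k τ) t) ≡ rename (liftRen k ρ) t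
  sub-liftRen-var k eq t = trans (sub-rename (liftSub-liftRen k (λ _ → refl)) t) (sub-var (liftSub-var k eq) t)

  renameArgs-subArgs-commute : ∀ {a b c d ks} {ρ : Fin b → Fin d} {σ₁ : Fin a → Tm b} {σ₂ : Fin c → Tm d} {τ : Fin a → Fin c} →
                               rename ρ ∘ σ₁ ≗ σ₂ ∘ τ →
                               ∀ (as : Args a ks) → renameArgs ρ (subArgs σ₁ as) ≡ subArgs σ₂ (renameArgs τ as)
  renameArgs-subArgs-commute eq as = trans (renameArgs-subArgs (λ _ → refl) as)
    (trans (subArgs-cong eq as) (sym (subArgs-renameArgs (λ _ → refl) as)))

  rename-sub-rename : ∀ {a b c d} (ρ : Fin c → Fin d) (σ′ : Fin b → Tm c) (τ : Fin a → Fin b) t →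
                      rename ρ (sub σ′ (rename τ t)) ≡ sub (rename ρ ∘ σ′ ∘ τ) t
  rename-sub-rename ρ σ′ τ t = trans (cong (rename ρ) (sub-rename (λ _ → refl) t)) (rename-sub (λ _ → refl) t)

  rename-sub-rename-sub : ∀ {a b c d e} (ρ : Fin d → Fin e) (σ₁ : Fin c → Tm d) (τ : Fin b → Fin c) (σ₂ : Fin a → Tm b) t →
                          rename ρ (sub σ₁ (rename τ (sub σ₂ t))) ≡ sub (rename ρ ∘ sub σ₁ ∘ rename τ ∘ σ₂) t
  rename-sub-rename-sub ρ σ₁ τ σ₂ t = begin
    rename ρ (sub σ₁ (rename τ (sub σ₂ t)))   ≡⟨ cong (rename ρ ∘ sub σ₁) (rename-sub (λ _ → refl) t) ⟩
    rename ρ (sub σ₁ (sub (rename τ ∘ σ₂) t)) ≡⟨ cong (rename ρ) (sub-sub (λ _ → refl) t) ⟩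
    rename ρ (sub (sub σ₁ ∘ rename τ ∘ σ₂) t) ≡⟨ rename-sub (λ _ → refl) t ⟩
    sub (rename ρ ∘ sub σ₁ ∘ rename τ ∘ σ₂) t ∎
    where open ≡-Reasoning

-- The initial algebra as linear raw syntax

module Model (S : BindingSig) (T : Species) (η : Hom V T) (φ : Hom (ΣF S T) T)
             (init : IsInitialAlg S T η φ) where
  open Syntax S

  Raw : Species
  Raw = record
    { obj = λ n → setoid (Tm n)
    ; act = λ g → rename (to g)
    ; act-cong = λ {_} {_} {f} {g} {x} {y} f≗g x≡y → trans (cong (rename (to f)) x≡y) (rename-cong f≗g y)
    ; act-id = rename-id (λ _ → refl)
    ; act-∘ = λ g f t → sym (rename-∘ (to g) (to f) t)
    }

  toArgs : ∀ ks {b n} → (Fin b → Fin n) → El (prodL ks Raw) b → Args n ks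
  toArgs [] ρ e = []
  toArgs (k ∷ []) ρ x = rename (liftRen k ρ) (unfoldδ Raw k x) ∷ []
  toArgs (k ∷ l ∷ ks) ρ (day {m₁} {m₂} x y f) =
    rename (liftRen k (ρ ∘ to f ∘ (_↑ˡ m₂))) (unfoldδ Raw k x) ∷ toArgs (l ∷ ks) (ρ ∘ to f ∘ (m₁ ↑ʳ_)) y

  toArgs-cong : ∀ ks {b n} {ρ ρ′ : Fin b → Fin n} → ρ ≗ ρ′ → (e : El (prodL ks Raw) b) → toArgs ks ρ e ≡ toArgs ks ρ′ e
  toArgs-cong [] eq e = refl
  toArgs-cong (k ∷ []) eq x = cong (_∷ []) (rename-cong (liftRen-cong k eq) (unfoldδ Raw k x))
  toArgs-cong (k ∷ l ∷ ks) eq (day x y f) =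
    cong₂ _∷_ (rename-cong (liftRen-cong k (λ _ → eq _)) (unfoldδ Raw k x)) (toArgs-cong (l ∷ ks) (λ _ → eq _) y)

  renameArgs-toArgs : ∀ ks {b n n′} (τ : Fin n → Fin n′) (ρ : Fin b → Fin n) (e : El (prodL ks Raw) b) →
                      renameArgs τ (toArgs ks ρ e) ≡ toArgs ks (τ ∘ ρ) e
  renameArgs-toArgs [] τ ρ e = refl
  renameArgs-toArgs (k ∷ []) τ ρ x = cong (_∷ []) (rename-∘≗ (λ i → sym (liftRen-∘ k τ ρ i)) (unfoldδ Raw k x))
  renameArgs-toArgs (k ∷ l ∷ ks) τ ρ (day x y f) =
    cong₂ _∷_ (rename-∘≗ (λ i → sym (liftRen-∘ k τ _ i)) (unfoldδ Raw k x)) (renameArgs-toArgs (l ∷ ks) τ _ y)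

  toArgs-rename : ∀ ks {b n} (ρ : Fin b → Fin n) (e : El (prodL ks Raw) b) → toArgs ks ρ e ≡ renameArgs ρ (toArgs ks (λ i → i) e)
  toArgs-rename ks ρ e = sym (renameArgs-toArgs ks ρ (λ i → i) e)

  rename-unfoldδ-act : ∀ k {a b n} (ρ : Fin b → Fin n) (g : Perm a b) (x : El (δ^ k Raw) a) →
                       rename (liftRen k ρ) (unfoldδ Raw k (act (δ^ k Raw) g x)) ≡ rename (liftRen k (ρ ∘ to g)) (unfoldδ Raw k x)
  rename-unfoldδ-act k ρ g x = trans (cong (rename (liftRen k ρ)) (unfoldδ-act Raw k g x))
    (rename-∘≗ (λ i → trans (cong (liftRen k ρ) (to-liftPerm k g i)) (sym (liftRen-∘ k ρ (to g) i))) (unfoldδ Raw k x))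

  toArgs-act : ∀ ks {a b n} (ρ : Fin b → Fin n) (g : Perm a b) (e : El (prodL ks Raw) a) →
               toArgs ks ρ (act (prodL ks Raw) g e) ≡ toArgs ks (ρ ∘ to g) e
  toArgs-act [] ρ g e = refl
  toArgs-act (k ∷ []) ρ g x = cong (_∷ []) (rename-unfoldδ-act k ρ g x)
  toArgs-act (k ∷ l ∷ ks) ρ g (day x y f) = refl

  toArgs-DayR : ∀ k l ks {b n} (ρ : Fin b → Fin n) {e e′} → DayR (δ^ k Raw) (prodL (l ∷ ks) Raw) e e′ →
                toArgs (k ∷ l ∷ ks) ρ e ≡ toArgs (k ∷ l ∷ ks) ρ e′
  toArgs-≈ : ∀ ks {b n} (ρ : Fin b → Fin n) {e e′ : El (prodL ks Raw) b} → Eq (prodL ks Raw) b e e′ →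
             toArgs ks ρ e ≡ toArgs ks ρ e′

  toArgs-DayR k l ks ρ (gen {m₁} {m₂} {m₁′} {m₂′} {x} {x′} {y} {y′} {f} {f′} α β x≈ y≈ f≗) = sym (cong₂ _∷_
    (begin
      rename (liftRen k (ρ ∘ to f′ ∘ (_↑ˡ m₂′))) (unfoldδ Raw k x′)
        ≡⟨ cong (rename _) (unfoldδ-≈ Raw k x≈) ⟨
      rename (liftRen k (ρ ∘ to f′ ∘ (_↑ˡ m₂′))) (unfoldδ Raw k (act (δ^ k Raw) α x))
        ≡⟨ rename-unfoldδ-act k _ α x ⟩
      rename (liftRen k (ρ ∘ to f′ ∘ (_↑ˡ m₂′) ∘ to α)) (unfoldδ Raw k x)
        ≡⟨ rename-cong (liftRen-cong k (λ i → cong ρ (trans (cong (to f′) (sym (to-⊕-↑ˡ α β i))) (sym (f≗ _))))) _ ⟩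
      rename (liftRen k (ρ ∘ to f ∘ (_↑ˡ m₂))) (unfoldδ Raw k x) ∎)
    (begin
      toArgs (l ∷ ks) (ρ ∘ to f′ ∘ (m₁′ ↑ʳ_)) y′                 ≡⟨ toArgs-≈ (l ∷ ks) _ y≈ ⟨
      toArgs (l ∷ ks) (ρ ∘ to f′ ∘ (m₁′ ↑ʳ_)) (act (prodL (l ∷ ks) Raw) β y) ≡⟨ toArgs-act (l ∷ ks) _ β y ⟩
      toArgs (l ∷ ks) (ρ ∘ to f′ ∘ (m₁′ ↑ʳ_) ∘ to β) y
        ≡⟨ toArgs-cong (l ∷ ks) (λ j → cong ρ (trans (cong (to f′) (sym (to-⊕-↑ʳ α β j))) (sym (f≗ _)))) y ⟩
      toArgs (l ∷ ks) (ρ ∘ to f ∘ (m₁ ↑ʳ_)) y                     ∎))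
    where open ≡-Reasoning

  toArgs-≈ [] ρ eq = refl
  toArgs-≈ (k ∷ []) ρ eq = cong (λ z → rename (liftRen k ρ) z ∷ []) (unfoldδ-≈ Raw k eq)
  toArgs-≈ (k ∷ l ∷ ks) ρ eq = closure eq
    where
    closure : ∀ {e e′} → EqClosure (DayR (δ^ k Raw) (prodL (l ∷ ks) Raw)) e e′ →
              toArgs (k ∷ l ∷ ks) ρ e ≡ toArgs (k ∷ l ∷ ks) ρ e′
    closure ε = refl
    closure (fwd r ◅ rs) = trans (toArgs-DayR k l ks ρ r) (closure rs)
    closure (bwd r ◅ rs) = trans (sym (toArgs-DayR k l ks ρ r)) (closure rs)

  varHom : Hom V Raw
  varHom = record { fun = λ v → var (to v Fin.zero) ; fun-cong = λ eq → cong var (eq _) ; natural = λ f v → refl }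

  opHom : Hom (ΣF S Raw) Raw
  opHom = record
    { fun = λ { (ω , e) → op ω (toArgs (arity S ω) (λ i → i) e) }
    ; fun-cong = λ { {_} {ω , e} {.ω , e′} (inj≈ eq) → cong (op ω) (toArgs-≈ (arity S ω) _ eq) }
    ; natural = λ { g (ω , e) →
        cong (op ω) (trans (toArgs-act (arity S ω) _ g e) (sym (renameArgs-toArgs (arity S ω) (to g) _ e))) }
    }

  rawHom : Hom T Raw
  rawHom = proj₁ (init Raw varHom opHom)

  rawHom-isAlgHom : IsAlgHom S η φ varHom opHom rawHom
  rawHom-isAlgHom = proj₁ (proj₂ (init Raw varHom opHom))

  raw : ∀ {n} → El T n → Tm n
  raw = fun rawHom

  raw-η : ∀ {n} (v : El V n) → raw (fun η v) ≡ var (to v Fin.zero)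
  raw-η = proj₁ rawHom-isAlgHom _

  raw-φ : ∀ {n} ω (e : El (prodL (arity S ω) T) n) →
          raw (fun φ (ω , e)) ≡ op ω (toArgs (arity S ω) (λ i → i) (prodL-map (arity S ω) raw e))
  raw-φ ω e = proj₂ rawHom-isAlgHom _ (ω , e)

  raw-cong : ∀ {n} {t t′ : El T n} → Eq T n t t′ → raw t ≡ raw t′
  raw-cong = fun-cong rawHom

  raw-act : ∀ {m n} (g : Perm m n) (t : El T m) → raw (act T g t) ≡ rename (to g) (raw t)
  raw-act = natural rawHom

  raw-unfoldδ : ∀ k {a} (x : El (δ^ k T) a) → unfoldδ Raw k (δ^-map k raw x) ≡ raw (unfoldδ T k x)
  raw-unfoldδ k x = unfoldδ-map k {T} {Raw} raw x

  idHom : Hom T T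
  idHom = record { fun = λ x → x ; fun-cong = λ eq → eq ; natural = λ f x → ≈-refl {T} }

  idHom-isAlgHom : IsAlgHom S η φ η φ idHom
  idHom-isAlgHom = (λ n v → ≈-refl {T}) ,
    (λ { n (ω , e) → fun-cong φ (≈-reflexive {ΣF S T} (sym (cong (ω ,_) (prodL-map-id (arity S ω) {T} e)))) })

  algEndo-≈-id : ∀ (h : Hom T T) → IsAlgHom S η φ η φ h → ∀ {n} (t : El T n) → Eq T n (fun h t) t
  algEndo-≈-id h h-alg {n} t = ≈-trans {T} (unique h h-alg n t) (≈-sym {T} (unique idHom idHom-isAlgHom n t))
    where
    unique : ∀ h → IsAlgHom S η φ η φ h → h ≈ₕ proj₁ (init T η φ)
    unique = proj₂ (proj₂ (init T η φ))

  All : (P : ∀ {n} → El T n → Set) → ∀ ks {b} → El (prodL ks T) b → Set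
  All P [] e = ⊤
  All P (k ∷ []) x = P (unfoldδ T k x)
  All P (k ∷ l ∷ ks) (day x y f) = P (unfoldδ T k x) × All P (l ∷ ks) y

  -- the subspecies of T cut out by P is a subalgebra, so initiality forces it to be everything
  module Induction (P : ∀ {n} → El T n → Set)
                   (P-resp : ∀ {n} {t t′ : El T n} → Eq T n t t′ → P t → P t′)
                   (P-act : ∀ {m n} (g : Perm m n) {t : El T m} → P t → P (act T g t))
                   (P-η : ∀ {n} (v : El V n) → P (fun η v))
                   (P-φ : ∀ {n} ω (e : El (prodL (arity S ω) T) n) → All P (arity S ω) e → P (fun φ (ω , e))) where

    Sub : Species
    Sub = record
      { obj = λ n → record { Carrier = Σ (El T n) P ; _≈_ = λ a b → Eq T n (proj₁ a) (proj₁ b)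
                           ; isEquivalence = record { refl = ≈-refl {T} ; sym = ≈-sym {T} ; trans = ≈-trans {T} } }
      ; act = λ g a → act T g (proj₁ a) , P-act g (proj₂ a)
      ; act-cong = act-cong T
      ; act-id = λ a → act-id T (proj₁ a)
      ; act-∘ = λ g f a → act-∘ T g f (proj₁ a)
      }

    inclusion : Hom Sub T
    inclusion = record { fun = proj₁ ; fun-cong = λ eq → eq ; natural = λ f x → ≈-refl {T} }

    all-P : ∀ ks {b} (e : El (prodL ks Sub) b) → All P ks (prodL-map ks proj₁ e)
    all-P [] e = tt
    all-P (k ∷ []) x = subst P (sym (unfoldδ-map k proj₁ x)) (proj₂ (unfoldδ Sub k x))
    all-P (k ∷ l ∷ ks) (day x y f) = subst P (sym (unfoldδ-map k proj₁ x)) (proj₂ (unfoldδ Sub k x)) , all-P (l ∷ ks) y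

    Sub-η : Hom V Sub
    Sub-η = record { fun = λ v → fun η v , P-η v ; fun-cong = fun-cong η ; natural = natural η }

    Sub-φ : Hom (ΣF S Sub) Sub
    Sub-φ = record
      { fun = λ { (ω , e) → fun φ (ω , prodL-map (arity S ω) proj₁ e) , P-φ ω _ (all-P (arity S ω) e) }
      ; fun-cong = λ eq → fun-cong φ (ΣF-map-cong inclusion S eq)
      ; natural = λ g e → ≈-trans {T} (fun-cong φ (ΣF-map-natural inclusion S g e)) (natural φ g _)
      }

    toSub : Hom T Sub
    toSub = proj₁ (init Sub Sub-η Sub-φ)

    toSub-isAlgHom : IsAlgHom S η φ Sub-η Sub-φ toSub
    toSub-isAlgHom = proj₁ (proj₂ (init Sub Sub-η Sub-φ))

    retraction : Hom T T
    retraction = record { fun = proj₁ ∘ fun toSub ; fun-cong = fun-cong toSub ; natural = natural toSub }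

    retraction-isAlgHom : IsAlgHom S η φ η φ retraction
    retraction-isAlgHom = proj₁ toSub-isAlgHom ,
      (λ { n (ω , e) → ≈-trans {T} (proj₂ toSub-isAlgHom n (ω , e))
            (fun-cong φ (≈-reflexive {ΣF S T} (cong (ω ,_) (prodL-map-∘ (arity S ω) {T} {Sub} {T} proj₁ (fun toSub) e)))) })

    induction : ∀ {n} (t : El T n) → P t
    induction t = P-resp (algEndo-≈-id retraction retraction-isAlgHom t) (proj₂ (fun toSub t))

  data VarOrOp {n} (t : El T n) : Set where
    isVar : ∀ v → Eq T n t (fun η v) → VarOrOp t
    isOp  : ∀ e → Eq T n t (fun φ e) → VarOrOp t

  var-or-op : ∀ {n} (t : El T n) → VarOrOp t
  var-or-op = Induction.induction VarOrOp resp act-resp (λ v → isVar v (≈-refl {T})) (λ ω e _ → isOp (ω , e) (≈-refl {T}))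
    where
    resp : ∀ {n} {t t′ : El T n} → Eq T n t t′ → VarOrOp t → VarOrOp t′
    resp t≈t′ (isVar v eq) = isVar v (≈-trans {T} (≈-sym {T} t≈t′) eq)
    resp t≈t′ (isOp e eq) = isOp e (≈-trans {T} (≈-sym {T} t≈t′) eq)
    act-resp : ∀ {m n} (g : Perm m n) {t : El T m} → VarOrOp t → VarOrOp (act T g t)
    act-resp g (isVar v eq) = isVar (act V g v) (≈-trans {T} (act-cong T (λ _ → refl) eq) (≈-sym {T} (natural η g v)))
    act-resp g (isOp e eq) = isOp (act (ΣF S T) g e) (≈-trans {T} (act-cong T (λ _ → refl) eq) (≈-sym {T} (natural φ g e)))

  AllOccur : ∀ {n} → El T n → Set
  AllOccur t = ∀ ℓ → Occurs ℓ (raw t)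

  allOccur-toArgs : ∀ ks {b n} (e : El (prodL ks T) b) → All AllOccur ks e → (ρ : Fin b → Fin n) →
                    ∀ j → OccursArgs (ρ j) (toArgs ks ρ (prodL-map ks raw e))
  allOccur-toArgs [] e _ ρ j with from e j
  ... | ()
  allOccur-toArgs (k ∷ []) x occ ρ j =
    head (subst (λ z → Occurs z _) (liftRen-weaken k ρ j)
           (occurs-rename (liftRen k ρ) (subst (Occurs (weaken k j)) (sym (raw-unfoldδ k x)) (occ (weaken k j)))))
  allOccur-toArgs (k ∷ l ∷ ks) {n = n} (day {m₁} {m₂} x y f) (occ-x , occ-y) ρ j =
    locate (allOccur-toArgs (l ∷ ks) y occ-y ρʳ) (split m₁ m₂ (from f j))
    where
    ρʳ : Fin m₂ → Fin n
    ρʳ = ρ ∘ to f ∘ (m₁ ↑ʳ_)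
    locate : (∀ i → OccursArgs (ρʳ i) (toArgs (l ∷ ks) ρʳ (prodL-map (l ∷ ks) raw y))) → Split m₁ m₂ (from f j) →
             OccursArgs (ρ j) (toArgs (k ∷ l ∷ ks) ρ (prodL-map (k ∷ l ∷ ks) raw (day x y f)))
    locate _ (left i eq) = head (subst (λ z → Occurs z _) (trans (liftRen-weaken k _ i) (cong (weaken k ∘ ρ) f[i]≡j))
        (occurs-rename (liftRen k _) (subst (Occurs (weaken k i)) (sym (raw-unfoldδ k x)) (occ-x (weaken k i)))))
      where
      f[i]≡j : to f (i ↑ˡ m₂) ≡ j
      f[i]≡j = trans (cong (to f) (sym eq)) (to-from f j)
    locate occ-tail (right i eq) = tail (subst (λ z → OccursArgs z (toArgs (l ∷ ks) ρʳ (prodL-map (l ∷ ks) raw y))) f[i]≡j (occ-tail i))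
      where
      f[i]≡j : ρ (to f (m₁ ↑ʳ i)) ≡ ρ j
      f[i]≡j = cong ρ (trans (cong (to f) (sym eq)) (to-from f j))

  allOccur : ∀ {n} (t : El T n) → AllOccur t
  allOccur = Induction.induction AllOccur resp act-resp occurs-η occurs-φ
    where
    resp : ∀ {n} {t t′ : El T n} → Eq T n t t′ → AllOccur t → AllOccur t′
    resp t≈t′ occ ℓ = subst (Occurs ℓ) (raw-cong t≈t′) (occ ℓ)
    act-resp : ∀ {m n} (g : Perm m n) {t : El T m} → AllOccur t → AllOccur (act T g t)
    act-resp g {t} occ ℓ = subst₂ Occurs (to-from g ℓ) (sym (raw-act g t)) (occurs-rename (to g) (occ (from g ℓ)))
    occurs-η : ∀ {n} (v : El V n) → AllOccur (fun η v)
    occurs-η v ℓ = subst (Occurs ℓ) (sym (raw-η v))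
      (subst (λ z → Occurs ℓ (var z)) (trans (sym (to-from v ℓ)) (cong (to v) (Fin1-zero (from v ℓ)))) here)
    occurs-φ : ∀ {n} ω (e : El (prodL (arity S ω) T) n) → All AllOccur (arity S ω) e → AllOccur (fun φ (ω , e))
    occurs-φ ω e occ ℓ = subst (Occurs ℓ) (sym (raw-φ ω e)) (inOp (allOccur-toArgs (arity S ω) e occ (λ i → i) ℓ))

  Determined : ∀ {n} → El T n → Set
  Determined {n} t = ∀ t′ → raw t ≡ raw t′ → Eq T n t t′

  determined-resp : ∀ {n} {t t′ : El T n} → Eq T n t t′ → Determined t → Determined t′
  determined-resp t≈t′ det t″ eq = ≈-trans {T} (≈-sym {T} t≈t′) (det t″ (trans (raw-cong t≈t′) eq))

  determined-act : ∀ {m n} (g : Perm m n) {t : El T m} → Determined t → Determined (act T g t)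
  determined-act g {t} det t′ eq = begin
    act T g t                         ≈⟨ act-cong T (λ _ → refl) (det (act T (flip g) t′) raw-t≡) ⟩
    act T g (act T (flip g) t′)       ≈⟨ act-∘ T g (flip g) t′ ⟨
    act T (g ∘ₚ flip g) t′            ≈⟨ act-cong T (to-from g) (≈-refl {T}) ⟩
    act T idP t′                      ≈⟨ act-id T t′ ⟩
    t′                                ∎
    where
    open SetoidReasoning (obj T _)
    raw-t≡ : raw t ≡ raw (act T (flip g) t′)
    raw-t≡ = trans (sym (rename-id (from-to g) (raw t)))
      (trans (sym (rename-∘ (from g) (to g) (raw t)))
      (trans (cong (rename (from g)) (trans (sym (raw-act g t)) eq)) (sym (raw-act (flip g) t′))))

  determined-renamed : ∀ k {a a′ n} (x : El (δ^ k T) a) (x′ : El (δ^ k T) a′) (α : Perm a a′)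
                       {ρ : Fin a → Fin n} {ρ′ : Fin a′ → Fin n} → Injective _≡_ _≡_ ρ′ → ρ′ ∘ to α ≗ ρ →
                       Determined (unfoldδ T k x) →
                       rename (liftRen k ρ) (raw (unfoldδ T k x)) ≡ rename (liftRen k ρ′) (raw (unfoldδ T k x′)) →
                       Eq (δ^ k T) a′ (act (δ^ k T) α x) x′
  determined-renamed k x x′ α {ρ} {ρ′} ρ′-inj ρ′α≗ρ det eq =
    unfoldδ-≈⁻ T k (subst (λ z → Eq T _ z (unfoldδ T k x′)) (sym (unfoldδ-act T k α x))
      (determined-act (liftPerm k α) det (unfoldδ T k x′)
        (rename-injective (liftRen-injective k ρ′-inj) _ _
          (trans (cong (rename (liftRen k ρ′)) (raw-act (liftPerm k α) (unfoldδ T k x)))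
          (trans (rename-∘≗ liftRen-α (raw (unfoldδ T k x))) eq)))))
    where
    liftRen-α : liftRen k ρ′ ∘ to (liftPerm k α) ≗ liftRen k ρ
    liftRen-α i = trans (cong (liftRen k ρ′) (to-liftPerm k α i)) (trans (sym (liftRen-∘ k ρ′ (to α) i)) (liftRen-cong k ρ′α≗ρ i))

  -- a variable of x is visible in the renamed term, so it is hit by the other renaming too
  matching-variable : ∀ k {a a′ n} (x : El (δ^ k T) a) (x′ : El (δ^ k T) a′) (κ : Fin a → Fin n) (κ′ : Fin a′ → Fin n) →
                      rename (liftRen k κ) (raw (unfoldδ T k x)) ≡ rename (liftRen k κ′) (raw (unfoldδ T k x′)) →
                      ∀ i → Σ[ j ∈ Fin a′ ] κ′ j ≡ κ i
  matching-variable k x x′ κ κ′ eq i with occurs-rename⁻ (liftRen k κ′) (raw (unfoldδ T k x′))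
      (subst (Occurs _) eq (occurs-rename (liftRen k κ) (allOccur (unfoldδ T k x) (weaken k i))))
  ... | ℓ , liftκ′ℓ≡ with liftRen-weaken⁻ k κ′ ℓ _ (trans liftκ′ℓ≡ (liftRen-weaken k κ i))
  ...   | j , _ , κ′j≡κi = j , κ′j≡κi

  args-determined : ∀ ks {b b′ n} (e : El (prodL ks T) b) (e′ : El (prodL ks T) b′) (β : Perm b b′)
                    (ρ : Fin b → Fin n) (ρ′ : Fin b′ → Fin n) → Injective _≡_ _≡_ ρ′ → ρ′ ∘ to β ≗ ρ →
                    All Determined ks e → toArgs ks ρ (prodL-map ks raw e) ≡ toArgs ks ρ′ (prodL-map ks raw e′) →
                    Eq (prodL ks T) b′ (act (prodL ks T) β e) e′
  args-determined [] e e′ β _ _ _ _ _ _ = λ ()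
  args-determined (k ∷ []) x x′ β ρ ρ′ ρ′-inj ρ′β≗ρ det eq = determined-renamed k x x′ β ρ′-inj ρ′β≗ρ det (begin
    rename (liftRen k ρ) (raw (unfoldδ T k x))              ≡⟨ cong (rename _) (raw-unfoldδ k x) ⟨
    rename (liftRen k ρ) (unfoldδ Raw k (δ^-map k raw x))   ≡⟨ proj₁ (∷-injective eq) ⟩
    rename (liftRen k ρ′) (unfoldδ Raw k (δ^-map k raw x′)) ≡⟨ cong (rename _) (raw-unfoldδ k x′) ⟩
    rename (liftRen k ρ′) (raw (unfoldδ T k x′))            ∎)
    where open ≡-Reasoning
  args-determined (k ∷ l ∷ ks) {n = n} (day {m₁} {m₂} x y f) (day {m₁′} {m₂′} x′ y′ f′) β ρ ρ′ ρ′-inj ρ′β≗ρ (det-x , det-y) eq =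
    fwd (gen leftPart rightPart x≈ (args-determined (l ∷ ks) y y′ rightPart _ _ ρ′ʳ-inj ρ′ʳ-match det-y (proj₂ (∷-injective eq)))
             (λ z → sym (f′∘decomposition z))) ◅ ε
    where
    κ : Fin m₁ → Fin n
    κ = ρ ∘ to f ∘ (_↑ˡ m₂)
    κ′ : Fin m₁′ → Fin n
    κ′ = ρ′ ∘ to f′ ∘ (_↑ˡ m₂′)

    heads≡ : rename (liftRen k κ) (raw (unfoldδ T k x)) ≡ rename (liftRen k κ′) (raw (unfoldδ T k x′))
    heads≡ = trans (cong (rename _) (sym (raw-unfoldδ k x))) (trans (proj₁ (∷-injective eq)) (cong (rename _) (raw-unfoldδ k x′)))

    π : Perm (m₁ + m₂) (m₁′ + m₂′)
    π = flip f′ ∘ₚ β ∘ₚ f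

    to-left : ∀ i → Σ[ j ∈ Fin m₁′ ] to π (i ↑ˡ m₂) ≡ j ↑ˡ m₂′
    to-left i with matching-variable k x x′ κ κ′ heads≡ i
    ... | j , κ′j≡κi = j , from-≡ f′ (ρ′-inj (trans κ′j≡κi (sym (ρ′β≗ρ _))))

    from-left : ∀ j → Σ[ i ∈ Fin m₁ ] from π (j ↑ˡ m₂′) ≡ i ↑ˡ m₂
    from-left j with matching-variable k x′ x κ′ κ (sym heads≡) j
    ... | i , κi≡κ′j = i , from-≡ f (sym (from-≡ β (ρ′-inj (trans (ρ′β≗ρ _) κi≡κ′j))))

    open BlockDecomposition π to-left from-left

    f′∘decomposition : ∀ z → to f′ (to (leftPart ⊕ rightPart) z) ≡ to β (to f z)
    f′∘decomposition z = trans (cong (to f′) (sym (decomposition z))) (to-from f′ _)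

    x≈ : Eq (δ^ k T) m₁′ (act (δ^ k T) leftPart x) x′
    x≈ = determined-renamed k x x′ leftPart (λ eq → ↑ˡ-injective m₂′ _ _ (to-injective f′ (ρ′-inj eq)))
      (λ i → trans (cong ρ′ (trans (cong (to f′) (sym (to-⊕-↑ˡ leftPart rightPart i))) (f′∘decomposition _))) (ρ′β≗ρ _))
      det-x heads≡

    ρ′ʳ-inj : Injective _≡_ _≡_ (ρ′ ∘ to f′ ∘ (m₁′ ↑ʳ_))
    ρ′ʳ-inj eq = ↑ʳ-injective m₁′ _ _ (to-injective f′ (ρ′-inj eq))

    ρ′ʳ-match : (ρ′ ∘ to f′ ∘ (m₁′ ↑ʳ_)) ∘ to rightPart ≗ ρ ∘ to f ∘ (m₁ ↑ʳ_)
    ρ′ʳ-match j = trans (cong ρ′ (trans (cong (to f′) (sym (to-⊕-↑ʳ leftPart rightPart j))) (f′∘decomposition _))) (ρ′β≗ρ _)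


  raw-determines : ∀ {n} (t : El T n) → Determined t
  raw-determines = Induction.induction Determined determined-resp determined-act determined-η determined-φ
    where
    determined-η : ∀ {n} (v : El V n) → Determined (fun η v)
    determined-η v t′ eq with var-or-op t′
    ... | isVar v′ t′≈ = ≈-trans {T} (fun-cong η v≗v′) (≈-sym {T} t′≈)
      where
      v≗v′ : v ≗ₚ v′
      v≗v′ i = subst (λ z → to v z ≡ to v′ z) (sym (Fin1-zero i))
        (var-injective (trans (sym (raw-η v)) (trans eq (trans (raw-cong t′≈) (raw-η v′)))))
    ... | isOp e t′≈ with trans (sym (raw-η v)) (trans eq (trans (raw-cong t′≈) (raw-φ _ (proj₂ e))))
    ...   | ()
    determined-φ : ∀ {n} ω (e : El (prodL (arity S ω) T) n) → All Determined (arity S ω) e → Determined (fun φ (ω , e))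
    determined-φ ω e det t′ eq with var-or-op t′
    ... | isVar v′ t′≈ with trans (sym (raw-φ ω e)) (trans eq (trans (raw-cong t′≈) (raw-η v′)))
    ...   | ()
    determined-φ ω e det t′ eq | isOp (ω′ , e′) t′≈ with trans (sym (raw-φ ω e)) (trans eq (trans (raw-cong t′≈) (raw-φ ω′ e′)))
    ...   | ops≡ with op-injectiveˡ ops≡
    ...     | refl = ≈-trans {T} (fun-cong φ (inj≈ e≈e′)) (≈-sym {T} t′≈)
      where
      e≈e′ : Eq (prodL (arity S ω) T) _ e e′
      e≈e′ = ≈-trans {prodL (arity S ω) T} (≈-sym {prodL (arity S ω) T} (act-id (prodL (arity S ω) T) e))
        (args-determined (arity S ω) e e′ idP (λ i → i) (λ i → i) (λ eq → eq) (λ _ → refl) det (op-injectiveʳ ops≡))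

  raw-injective : ∀ {n} {t t′ : El T n} → raw t ≡ raw t′ → Eq T n t t′
  raw-injective {t = t} {t′} = raw-determines t t′

  SubstClosed : ∀ {N} → El T N → Set
  SubstClosed {N} x = ∀ m (p : Perm N (m + 1)) k (u : El T k) →
                      Σ[ r ∈ El T (m + k) ] raw r ≡ sub (substLast (raw u) ∘ to p) (raw x)

  module Substituting {k : ℕ} (u : El T k) where

    record ReplacesOne {N M′} (σ : Fin N → Tm M′) : Set where
      constructor replacesOne
      field
        {M} : ℕ
        hole : Perm N (M + 1)
        rest : Perm (M + k) M′
        shape : σ ≗ rename (to rest) ∘ substLast (raw u) ∘ to hole

    liftRest : ∀ {M M′} → Perm (M + k) M′ → Perm ((M + 1) + k) (M′ + 1)
    liftRest {M} Q = sendBack {M} {k} 1 Q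

    replacesOne-base : ∀ {N m} (g : Perm N (m + 1)) → ReplacesOne (substLast (raw u) ∘ to g)
    replacesOne-base g = replacesOne g idP (λ i → sym (rename-id (λ _ → refl) _))

    replacesOne-apply : ∀ {N M′} {x : El T N} {σ : Fin N → Tm M′} → SubstClosed x → ReplacesOne σ →
                        Σ[ r ∈ El T M′ ] raw r ≡ sub σ (raw x)
    replacesOne-apply {x = x} {σ} closed (replacesOne {M} G Q shape) with closed M G k u
    ... | r , raw-r≡ = act T Q r , (begin
      raw (act T Q r)                                              ≡⟨ raw-act Q r ⟩
      rename (to Q) (raw r)                                        ≡⟨ cong (rename (to Q)) raw-r≡ ⟩
      rename (to Q) (sub (substLast (raw u) ∘ to G) (raw x))       ≡⟨ rename-sub (λ _ → refl) (raw x) ⟩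
      sub (rename (to Q) ∘ substLast (raw u) ∘ to G) (raw x)       ≡⟨ sub-cong (λ i → sym (shape i)) (raw x) ⟩
      sub σ (raw x)                                                ∎)
      where open ≡-Reasoning

    private
      renamed-old : ∀ {M M′} (Q : Perm (M + k) M′) t →
                    rename (_↑ˡ 1) (rename (to Q) (substLast (raw u) (t ↑ˡ 1))) ≡
                    rename (to (liftRest Q)) (substLast (raw u) ((t ↑ˡ 1) ↑ˡ 1))
      renamed-old {M} Q t = begin
        rename (_↑ˡ 1) (rename (to Q) (substLast (raw u) (t ↑ˡ 1)))  ≡⟨ cong (rename (_↑ˡ 1) ∘ rename (to Q)) (substLast-↑ˡ (raw u) t) ⟩
        var (to Q (t ↑ˡ k) ↑ˡ 1)                                      ≡⟨ cong var (sendBack-↑ˡ {M} {k} 1 Q t) ⟨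
        var (to (liftRest Q) ((t ↑ˡ 1) ↑ˡ k))                          ≡⟨ cong (rename (to (liftRest Q))) (substLast-↑ˡ (raw u) (t ↑ˡ 1)) ⟨
        rename (to (liftRest Q)) (substLast (raw u) ((t ↑ˡ 1) ↑ˡ 1))   ∎
        where open ≡-Reasoning

      renamed-hole : ∀ {M M′} (Q : Perm (M + k) M′) z →
                     rename (_↑ˡ 1) (rename (to Q) (substLast (raw u) (M ↑ʳ z))) ≡
                     rename (to (liftRest Q)) (substLast (raw u) ((M + 1) ↑ʳ z))
      renamed-hole {M} Q z = begin
        rename (_↑ˡ 1) (rename (to Q) (substLast (raw u) (M ↑ʳ z)))   ≡⟨ cong (rename (_↑ˡ 1) ∘ rename (to Q)) (substLast-↑ʳ (raw u) z) ⟩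
        rename (_↑ˡ 1) (rename (to Q) (rename (M ↑ʳ_) (raw u)))       ≡⟨ cong (rename (_↑ˡ 1)) (rename-∘ (to Q) (M ↑ʳ_) (raw u)) ⟩
        rename (_↑ˡ 1) (rename (to Q ∘ (M ↑ʳ_)) (raw u))              ≡⟨ rename-∘≗ (λ w → sym (sendBack-↑ʳ {M} {k} 1 Q w)) (raw u) ⟩
        rename (to (liftRest Q) ∘ ((M + 1) ↑ʳ_)) (raw u)               ≡⟨ rename-∘ (to (liftRest Q)) ((M + 1) ↑ʳ_) (raw u) ⟨
        rename (to (liftRest Q)) (rename ((M + 1) ↑ʳ_) (raw u))        ≡⟨ cong (rename (to (liftRest Q))) (substLast-↑ʳ (raw u) z) ⟨
        rename (to (liftRest Q)) (substLast (raw u) ((M + 1) ↑ʳ z))    ∎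
        where open ≡-Reasoning

    -- under a binder the hole moves past the new variable, which the renaming then puts back last
    replacesOne-lift₁ : ∀ {N M′} {σ : Fin N → Tm M′} → ReplacesOne σ → ReplacesOne (liftSub₁ σ)
    replacesOne-lift₁ {N} {M′} {σ} (replacesOne {M} G Q shape) =
      replacesOne (swapPerm M ∘ₚ (G ⊕ idP {1})) (liftRest Q) lifted-shape
      where
      old : ∀ w → rename (_↑ˡ 1) (rename (to Q) (substLast (raw u) w)) ≡
                  rename (to (liftRest Q)) (substLast (raw u) (to (swapPerm M) (w ↑ˡ 1)))
      old w with split M 1 w
      ... | left t refl = trans (renamed-old Q t) (cong (rename (to (liftRest Q)) ∘ substLast (raw u)) (sym (swapPerm-↑ˡ t)))
      ... | right z refl = trans (renamed-hole Q z) (cong (rename (to (liftRest Q)) ∘ substLast (raw u)) (sym (swapPerm-↑ʳ↑ˡ z)))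

      lifted-shape : liftSub₁ σ ≗ rename (to (liftRest Q)) ∘ substLast (raw u) ∘ to (swapPerm M ∘ₚ (G ⊕ idP {1}))
      lifted-shape i with split N 1 i
      ... | left j refl = begin
        liftSub₁ σ (j ↑ˡ 1)                                              ≡⟨ liftSub₁-↑ˡ σ j ⟩
        rename (_↑ˡ 1) (σ j)                                             ≡⟨ cong (rename (_↑ˡ 1)) (shape j) ⟩
        rename (_↑ˡ 1) (rename (to Q) (substLast (raw u) (to G j)))      ≡⟨ old (to G j) ⟩
        rename (to (liftRest Q)) (substLast (raw u) (to (swapPerm M) (to G j ↑ˡ 1)))
          ≡⟨ cong (rename (to (liftRest Q)) ∘ substLast (raw u) ∘ to (swapPerm M)) (to-⊕-↑ˡ G idP j) ⟨
        rename (to (liftRest Q)) (substLast (raw u) (to (swapPerm M) (to (G ⊕ idP) (j ↑ˡ 1)))) ∎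
        where open ≡-Reasoning
      ... | right z refl = begin
        liftSub₁ σ (N ↑ʳ z)                                              ≡⟨ liftSub₁-↑ʳ σ z ⟩
        var (M′ ↑ʳ z)                                                    ≡⟨ cong var (sendBack-↑ʳ↑ˡ {M} {k} 1 Q z) ⟨
        var (to (liftRest Q) ((M ↑ʳ z) ↑ˡ k))
          ≡⟨ cong (rename (to (liftRest Q))) (substLast-↑ˡ (raw u) (M ↑ʳ z)) ⟨
        rename (to (liftRest Q)) (substLast (raw u) ((M ↑ʳ z) ↑ˡ 1))
          ≡⟨ cong (rename (to (liftRest Q)) ∘ substLast (raw u)) (swapPerm-↑ʳ z) ⟨
        rename (to (liftRest Q)) (substLast (raw u) (to (swapPerm M) ((M + 1) ↑ʳ z)))
          ≡⟨ cong (rename (to (liftRest Q)) ∘ substLast (raw u) ∘ to (swapPerm M)) (to-⊕-↑ʳ G idP z) ⟨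
        rename (to (liftRest Q)) (substLast (raw u) (to (swapPerm M) (to (G ⊕ idP) (N ↑ʳ z)))) ∎
        where open ≡-Reasoning

    replacesOne-lift : ∀ k′ {N M′} {σ : Fin N → Tm M′} → ReplacesOne σ → ReplacesOne (liftSub k′ σ)
    replacesOne-lift zero r = r
    replacesOne-lift (suc k′) r = replacesOne-lift k′ (replacesOne-lift₁ r)

    substUnder : ∀ k′ {b M′} (x : El (δ^ k′ T) b) → SubstClosed (unfoldδ T k′ x) → {σ : Fin b → Tm M′} → ReplacesOne σ →
                 Σ[ x′ ∈ El (δ^ k′ T) M′ ] raw (unfoldδ T k′ x′) ≡ sub (liftSub k′ σ) (raw (unfoldδ T k′ x))
    substUnder k′ x closed r with replacesOne-apply closed (replacesOne-lift k′ r)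
    ... | x′ , eq = foldδ T k′ x′ , trans (cong raw (unfoldδ-foldδ T k′ x′)) eq

    ArgsSubst : ∀ ks {b} (e : El (prodL ks T) b) m (g : Perm b (m + 1)) → Set
    ArgsSubst ks e m g = Σ[ e′ ∈ El (prodL ks T) (m + k) ]
      toArgs ks (λ i → i) (prodL-map ks raw e′) ≡ subArgs (substLast (raw u) ∘ to g) (toArgs ks (λ i → i) (prodL-map ks raw e))

    subst-in-head : ∀ k′ l ks {a c b m} (i : Fin a) (x : El (δ^ k′ T) a) (y : El (prodL (l ∷ ks) T) c)
                    (f : Perm (a + c) b) (g : Perm b (m + 1)) → SubstClosed (unfoldδ T k′ x) →
                    to (g ∘ₚ f) (i ↑ˡ c) ≡ m ↑ʳ Fin.zero → ArgsSubst (k′ ∷ l ∷ ks) (day x y f) m g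
    subst-in-head k′ l ks {zero} () x y f g closed hole
    subst-in-head k′ l ks {suc a′} {c} {b} {m} i x y f g closed hole = day x′ y newPerm , cong₂ _∷_ head≡ tail≡
      where
      open HoleInLeftBlock k i (g ∘ₚ f) hole
      substituted : Σ[ x′ ∈ El (δ^ k′ T) (a′ + k) ]
                    raw (unfoldδ T k′ x′) ≡ sub (liftSub k′ (substLast (raw u) ∘ to (moveLast i))) (raw (unfoldδ T k′ x))
      substituted = substUnder k′ x closed (replacesOne-base (moveLast i))
      x′ : El (δ^ k′ T) (a′ + k)
      x′ = proj₁ substituted

      head≡ : rename (liftRen k′ (to newPerm ∘ (_↑ˡ c))) (unfoldδ Raw k′ (δ^-map k′ raw x′)) ≡
              sub (liftSub k′ (substLast (raw u) ∘ to g)) (rename (liftRen k′ (to f ∘ (_↑ˡ c))) (unfoldδ Raw k′ (δ^-map k′ raw x)))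
      head≡ = begin
        rename (liftRen k′ (to newPerm ∘ (_↑ˡ c))) (unfoldδ Raw k′ (δ^-map k′ raw x′))
          ≡⟨ cong (rename _) (trans (raw-unfoldδ k′ x′) (proj₂ substituted)) ⟩
        rename (liftRen k′ (to newPerm ∘ (_↑ˡ c))) (sub (liftSub k′ (substLast (raw u) ∘ to (moveLast i))) (raw (unfoldδ T k′ x)))
          ≡⟨ rename-sub-commute k′ (λ j → trans (rename-cong newPerm-left _)
                                          (trans (substLast-extend (raw u) leftRenaming _) (cong (substLast (raw u)) (G-left j))))
                                    (raw (unfoldδ T k′ x)) ⟩
        sub (liftSub k′ (substLast (raw u) ∘ to g)) (rename (liftRen k′ (to f ∘ (_↑ˡ c))) (raw (unfoldδ T k′ x)))
          ≡⟨ cong (sub _ ∘ rename _) (raw-unfoldδ k′ x) ⟨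
        sub (liftSub k′ (substLast (raw u) ∘ to g)) (rename (liftRen k′ (to f ∘ (_↑ˡ c))) (unfoldδ Raw k′ (δ^-map k′ raw x))) ∎
        where open ≡-Reasoning

      tail≡ : toArgs (l ∷ ks) (to newPerm ∘ ((a′ + k) ↑ʳ_)) (prodL-map (l ∷ ks) raw y) ≡
              subArgs (substLast (raw u) ∘ to g) (toArgs (l ∷ ks) (to f ∘ (suc a′ ↑ʳ_)) (prodL-map (l ∷ ks) raw y))
      tail≡ = begin
        toArgs (l ∷ ks) (to newPerm ∘ ((a′ + k) ↑ʳ_)) ys                 ≡⟨ toArgs-rename (l ∷ ks) _ ys ⟩
        renameArgs (to newPerm ∘ ((a′ + k) ↑ʳ_)) (toArgs (l ∷ ks) (λ i → i) ys)
          ≡⟨ subArgs-var (λ j → cong var (sym (newPerm-right j))) _ ⟨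
        subArgs (λ j → var (rightRenaming j ↑ˡ k)) (toArgs (l ∷ ks) (λ i → i) ys)
          ≡⟨ subArgs-cong (λ j → trans (sym (substLast-↑ˡ (raw u) _)) (cong (substLast (raw u)) (sym (G-right j)))) _ ⟩
        subArgs (substLast (raw u) ∘ to g ∘ to f ∘ (suc a′ ↑ʳ_)) (toArgs (l ∷ ks) (λ i → i) ys)
          ≡⟨ subArgs-renameArgs (λ _ → refl) _ ⟨
        subArgs (substLast (raw u) ∘ to g) (renameArgs (to f ∘ (suc a′ ↑ʳ_)) (toArgs (l ∷ ks) (λ i → i) ys))
          ≡⟨ cong (subArgs _) (toArgs-rename (l ∷ ks) _ ys) ⟨
        subArgs (substLast (raw u) ∘ to g) (toArgs (l ∷ ks) (to f ∘ (suc a′ ↑ʳ_)) ys) ∎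
        where
        open ≡-Reasoning
        ys : El (prodL (l ∷ ks) Raw) c
        ys = prodL-map (l ∷ ks) raw y

    subst-in-tail : ∀ k′ l ks {a c b m} (j : Fin c) (x : El (δ^ k′ T) a) (y : El (prodL (l ∷ ks) T) c)
                    (f : Perm (a + c) b) (g : Perm b (m + 1)) → (∀ m′ (g′ : Perm c (m′ + 1)) → ArgsSubst (l ∷ ks) y m′ g′) →
                    to (g ∘ₚ f) (a ↑ʳ j) ≡ m ↑ʳ Fin.zero → ArgsSubst (k′ ∷ l ∷ ks) (day x y f) m g
    subst-in-tail k′ l ks {c = zero} () x y f g closed hole
    subst-in-tail k′ l ks {a} {suc c′} {b} {m} j x y f g closed hole = day x y′ newPerm , cong₂ _∷_ head≡ tail≡
      where
      open HoleInRightBlock k j (g ∘ₚ f) hole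
      substituted : ArgsSubst (l ∷ ks) y c′ (moveLast j)
      substituted = closed c′ (moveLast j)
      y′ : El (prodL (l ∷ ks) T) (c′ + k)
      y′ = proj₁ substituted

      head≡ : rename (liftRen k′ (to newPerm ∘ (_↑ˡ (c′ + k)))) (unfoldδ Raw k′ (δ^-map k′ raw x)) ≡
              sub (liftSub k′ (substLast (raw u) ∘ to g)) (rename (liftRen k′ (to f ∘ (_↑ˡ suc c′))) (unfoldδ Raw k′ (δ^-map k′ raw x)))
      head≡ = sym (sub-liftRen-var k′ (λ i → trans (cong (substLast (raw u)) (G-left i))
                                              (trans (substLast-↑ˡ (raw u) _) (cong var (sym (newPerm-left i))))) _)

      tail≡ : toArgs (l ∷ ks) (to newPerm ∘ (a ↑ʳ_)) (prodL-map (l ∷ ks) raw y′) ≡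
              subArgs (substLast (raw u) ∘ to g) (toArgs (l ∷ ks) (to f ∘ (a ↑ʳ_)) (prodL-map (l ∷ ks) raw y))
      tail≡ = begin
        toArgs (l ∷ ks) (to newPerm ∘ (a ↑ʳ_)) (prodL-map (l ∷ ks) raw y′)          ≡⟨ toArgs-rename (l ∷ ks) _ _ ⟩
        renameArgs (to newPerm ∘ (a ↑ʳ_)) (toArgs (l ∷ ks) (λ i → i) (prodL-map (l ∷ ks) raw y′))
          ≡⟨ cong (renameArgs _) (proj₂ substituted) ⟩
        renameArgs (to newPerm ∘ (a ↑ʳ_)) (subArgs (substLast (raw u) ∘ to (moveLast j)) (toArgs (l ∷ ks) (λ i → i) ys))
          ≡⟨ renameArgs-subArgs-commute (λ j₀ → trans (rename-cong newPerm-right _)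
                   (trans (substLast-extend (raw u) rightRenaming _) (cong (substLast (raw u)) (G-right j₀)))) _ ⟩
        subArgs (substLast (raw u) ∘ to g) (renameArgs (to f ∘ (a ↑ʳ_)) (toArgs (l ∷ ks) (λ i → i) ys))
          ≡⟨ cong (subArgs _) (toArgs-rename (l ∷ ks) _ ys) ⟨
        subArgs (substLast (raw u) ∘ to g) (toArgs (l ∷ ks) (to f ∘ (a ↑ʳ_)) ys) ∎
        where
        open ≡-Reasoning
        ys : El (prodL (l ∷ ks) Raw) (suc c′)
        ys = prodL-map (l ∷ ks) raw y

    substArgs : ∀ ks {b} (e : El (prodL ks T) b) → All SubstClosed ks e → ∀ m (g : Perm b (m + 1)) → ArgsSubst ks e m g
    substArgs [] e _ m g with from e (from g (m ↑ʳ Fin.zero))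
    ... | ()
    substArgs (k′ ∷ []) x closed m g with substUnder k′ x closed (replacesOne-base g)
    ... | x′ , eq = x′ , cong (_∷ []) (begin
      rename (liftRen k′ (λ i → i)) (unfoldδ Raw k′ (δ^-map k′ raw x′))   ≡⟨ rename-id (liftRen-id k′) _ ⟩
      unfoldδ Raw k′ (δ^-map k′ raw x′)                                  ≡⟨ trans (raw-unfoldδ k′ x′) eq ⟩
      sub (liftSub k′ (substLast (raw u) ∘ to g)) (raw (unfoldδ T k′ x))
        ≡⟨ cong (sub _) (trans (sym (raw-unfoldδ k′ x)) (sym (rename-id (liftRen-id k′) _))) ⟩
      sub (liftSub k′ (substLast (raw u) ∘ to g)) (rename (liftRen k′ (λ i → i)) (unfoldδ Raw k′ (δ^-map k′ raw x))) ∎)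
      where open ≡-Reasoning
    substArgs (k′ ∷ l ∷ ks) (day {a} {c} x y f) (closed-x , closed-y) m g =
      locate (substArgs (l ∷ ks) y closed-y) (split a c (from (g ∘ₚ f) (m ↑ʳ Fin.zero)))
      where
      locate : (∀ m′ (g′ : Perm c (m′ + 1)) → ArgsSubst (l ∷ ks) y m′ g′) → Split a c (from (g ∘ₚ f) (m ↑ʳ Fin.zero)) →
               ArgsSubst (k′ ∷ l ∷ ks) (day x y f) m g
      locate _ (left i eq) = subst-in-head k′ l ks i x y f g closed-x (trans (cong (to (g ∘ₚ f)) (sym eq)) (to-from (g ∘ₚ f) _))
      locate rec (right j eq) = subst-in-tail k′ l ks j x y f g rec (trans (cong (to (g ∘ₚ f)) (sym eq)) (to-from (g ∘ₚ f) _))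

  substClosed : ∀ {N} (x : El T N) → SubstClosed x
  substClosed = Induction.induction SubstClosed resp act-resp closed-η closed-φ
    where
    resp : ∀ {n} {t t′ : El T n} → Eq T n t t′ → SubstClosed t → SubstClosed t′
    resp t≈t′ closed m g k u with closed m g k u
    ... | r , eq = r , trans eq (cong (sub _) (raw-cong t≈t′))
    act-resp : ∀ {m n} (g : Perm m n) {t : El T m} → SubstClosed t → SubstClosed (act T g t)
    act-resp g {t} closed m p k u with closed m (p ∘ₚ g) k u
    ... | r , eq = r , trans eq (trans (sym (sub-rename (λ _ → refl) (raw t))) (cong (sub _) (sym (raw-act g t))))
    -- a variable has a single free variable, so m = 0 and the result is u itself
    closed-η : ∀ {n} (v : El V n) → SubstClosed (fun η v)
    closed-η v m p k u with +-cancelʳ-≡ 1 m 0 (sym (↔⇒≡ (p ∘ₚ v)))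
    ... | refl = u , trans (sym (rename-id (λ _ → refl) (raw u))) (cong (sub _) (sym (raw-η v)))
    closed-φ : ∀ {n} ω (e : El (prodL (arity S ω) T) n) → All SubstClosed (arity S ω) e → SubstClosed (fun φ (ω , e))
    closed-φ ω e closed m p k u with Substituting.substArgs u (arity S ω) e closed m p
    ... | e′ , eq = fun φ (ω , e′) , trans (raw-φ ω e′) (trans (cong (op ω) eq) (cong (sub _) (sym (raw-φ ω e))))

  substRep : ∀ {n} → DayEl (δ T) T n → Tm n
  substRep (day x u f) = rename (to f) (sub (substLast (raw u)) (raw x))

  substRep-DayR : ∀ {n} {e e′ : DayEl (δ T) T n} → DayR (δ T) T e e′ → substRep e ≡ substRep e′
  substRep-DayR (gen {x = x} {x′} {u} {u′} {f} {f′} α β x≈ u≈ f≗) = sym (begin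
    rename (to f′) (sub (substLast (raw u′)) (raw x′))
      ≡⟨ cong₂ (λ X U → rename (to f′) (sub (substLast U) X))
               (trans (sym (raw-cong x≈)) (raw-act (α ⊕ idP) x)) (trans (sym (raw-cong u≈)) (raw-act β u)) ⟩
    rename (to f′) (sub (substLast (rename (to β) (raw u))) (rename (to (α ⊕ idP)) (raw x)))
      ≡⟨ cong (rename (to f′)) (sub-rename (λ _ → refl) (raw x)) ⟩
    rename (to f′) (sub (substLast (rename (to β) (raw u)) ∘ to (α ⊕ idP)) (raw x))
      ≡⟨ cong (rename (to f′)) (sub-cong (substLast-⊕ α β (raw u)) (raw x)) ⟩
    rename (to f′) (sub (rename (to (α ⊕ β)) ∘ substLast (raw u)) (raw x))
      ≡⟨ cong (rename (to f′)) (rename-sub (λ _ → refl) (raw x)) ⟨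
    rename (to f′) (rename (to (α ⊕ β)) (sub (substLast (raw u)) (raw x)))
      ≡⟨ rename-∘≗ (λ i → sym (f≗ i)) _ ⟩
    rename (to f) (sub (substLast (raw u)) (raw x)) ∎)
    where open ≡-Reasoning

  substRep-≈ : ∀ {n} {e e′ : DayEl (δ T) T n} → EqClosure (DayR (δ T) T) e e′ → substRep e ≡ substRep e′
  substRep-≈ ε = refl
  substRep-≈ (fwd r ◅ rs) = trans (substRep-DayR r) (substRep-≈ rs)
  substRep-≈ (bwd r ◅ rs) = trans (sym (substRep-DayR r)) (substRep-≈ rs)

  substitute : ∀ {n} → DayEl (δ T) T n → El T n
  substitute (day {m₁} {m₂} x u f) = act T f (proj₁ (substClosed x m₁ idP m₂ u))

  raw-substitute : ∀ {n} (e : DayEl (δ T) T n) → raw (substitute e) ≡ substRep e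
  raw-substitute (day {m₁} {m₂} x u f) = trans (raw-act f _) (cong (rename (to f)) (proj₂ (substClosed x m₁ idP m₂ u)))

  σ : Hom (Day (δ T) T) T
  σ = record
    { fun = substitute
    ; fun-cong = λ {_} {e} {e′} e≈e′ → raw-injective (trans (raw-substitute e) (trans (substRep-≈ e≈e′) (sym (raw-substitute e′))))
    ; natural = λ { g (day x u f) → act-∘ T g f _ }
    }

  ν : Hom J (δ T)
  ν = record
    { fun = λ j → fun η (j ⊕ idP {1})
    ; fun-cong = λ {_} {j} {j′} j≗j′ → fun-cong η (⊕-cong {a = j} {a' = j′} {b = idP {1}} {b' = idP {1}} j≗j′ (λ _ → refl))
    ; natural = λ g j → ≈-trans {T} (fun-cong η (⊕-∘ g j (idP {1}) (idP {1}))) (natural η (g ⊕ idP {1}) (j ⊕ idP {1}))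
    }

  σ-ν-unitˡ : ∀ n (e : DayEl J T n) → Eq T n (fun σ ((fun ν ⊗₁ (λ z → z)) e)) (λ-rep T e)
  σ-ν-unitˡ n (day {m₁} {m₂} j x f) = raw-injective (begin
    raw (substitute (day (fun ν j) x f))                               ≡⟨ raw-substitute (day (fun ν j) x f) ⟩
    rename (to f) (sub (substLast (raw x)) (raw (fun η (j ⊕ idP))))    ≡⟨ cong (rename (to f) ∘ sub _) (raw-η (j ⊕ idP)) ⟩
    rename (to f) (substLast (raw x) (m₁ ↑ʳ Fin.zero))                 ≡⟨ cong (rename (to f)) (substLast-↑ʳ (raw x) Fin.zero) ⟩
    rename (to f) (rename (m₁ ↑ʳ_) (raw x))                            ≡⟨ rename-∘ (to f) (m₁ ↑ʳ_) (raw x) ⟩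
    rename (to (f ∘ₚ (j ⊕ idP {m₂}))) (raw x)                          ≡⟨ raw-act (f ∘ₚ (j ⊕ idP {m₂})) x ⟨
    raw (λ-rep T (day j x f))                                          ∎)
    where open ≡-Reasoning

  σ-ν-unitʳ : ∀ n (e : DayEl (δ T) J n) →
              Eq (δ T) n (fun σ (str'-rep (δ T) T (((λ z → z) ⊗₁ fun ν) e))) (r-rep (δ T) e)
  σ-ν-unitʳ n (day {m₁} {m₂} x j f) = raw-injective (begin
    raw (substitute (day x (fun ν j) F₁))                       ≡⟨ raw-substitute (day x (fun ν j) F₁) ⟩
    rename (to F₁) (sub (substLast (raw (fun η (j ⊕ idP)))) (raw x))
      ≡⟨ cong (λ v → rename (to F₁) (sub (substLast v) (raw x))) (raw-η (j ⊕ idP)) ⟩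
    rename (to F₁) (sub (substLast (var (m₂ ↑ʳ Fin.zero))) (raw x))  ≡⟨ rename-sub (λ _ → refl) (raw x) ⟩
    sub (rename (to F₁) ∘ substLast (var (m₂ ↑ʳ Fin.zero))) (raw x)  ≡⟨ sub-var pointwise (raw x) ⟩
    rename (to (P ⊕ idP {1})) (raw x)                                          ≡⟨ raw-act (P ⊕ idP {1}) x ⟨
    raw (r-rep (δ T) (day x j f))                                              ∎)
    where
    open ≡-Reasoning
    F₁ : Perm (m₁ + (m₂ + 1)) (n + 1)
    F₁ = reassoc {m₁} {m₂} 1 f
    P : Perm m₁ n
    P = f ∘ₚ (idP {m₁} ⊕ j) ∘ₚ castP (sym (+-identityʳ m₁))

    pointwise : rename (to F₁) ∘ substLast (var (m₂ ↑ʳ Fin.zero)) ≗ var ∘ to (P ⊕ idP {1})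
    pointwise i with split m₁ 1 i
    ... | left t refl = begin
      rename (to F₁) (substLast _ (t ↑ˡ 1))   ≡⟨ cong (rename _) (substLast-↑ˡ _ t) ⟩
      var (to F₁ (t ↑ˡ (m₂ + 1)))            ≡⟨ cong var (reassoc-↑ˡ {m₁} {m₂} 1 f t) ⟩
      var (to f (t ↑ˡ m₂) ↑ˡ 1)                          ≡⟨ cong (λ w → var (to f w ↑ˡ 1)) (to-⊕-↑ˡ idP j t) ⟨
      var (to f (to (idP ⊕ j) (t ↑ˡ 0)) ↑ˡ 1)            ≡⟨ cong (λ w → var (to f (to (idP ⊕ j) w) ↑ˡ 1)) t↑ˡ0 ⟨
      var (to P t ↑ˡ 1)                                  ≡⟨ cong var (to-⊕-↑ˡ P idP t) ⟨
      var (to (P ⊕ idP) (t ↑ˡ 1))                        ∎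
      where
      t↑ˡ0 : to (castP (sym (+-identityʳ m₁))) t ≡ t ↑ˡ 0
      t↑ˡ0 = castP-toℕ (sym (+-identityʳ m₁)) (sym (toℕ-↑ˡ t 0))
    ... | right z refl = begin
      rename (to F₁) (substLast _ (m₁ ↑ʳ z))  ≡⟨ cong (rename _) (substLast-↑ʳ {m₁} _ z) ⟩
      var (to F₁ (m₁ ↑ʳ (m₂ ↑ʳ Fin.zero)))    ≡⟨ cong var (reassoc-↑ʳ↑ʳ {m₁} {m₂} 1 f Fin.zero) ⟩
      var (n ↑ʳ Fin.zero)                                ≡⟨ cong (var ∘ (n ↑ʳ_)) (Fin1-zero z) ⟨
      var (n ↑ʳ z)                                       ≡⟨ cong var (to-⊕-↑ʳ P idP z) ⟨
      var (to (P ⊕ idP) (m₁ ↑ʳ z))                       ∎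

  σ-assoc : ∀ n (e : DayEl (Day (δ T) (δ T)) T n) →
            Eq T n (fun σ (((λ z → z) ⊗₁ fun σ) (assoc-rep (δ T) (δ T) T e)))
                   (fun σ (((λ e′ → fun σ (str'-rep (δ T) T e′)) ⊗₁ (λ z → z)) e))
  σ-assoc n (day {k₁} {m₃} (day {m₁} {m₂} x y g) z f) = raw-injective (begin
    raw (substitute (day x (substitute (day y z idP)) A))
      ≡⟨ raw-substitute _ ⟩
    rename (to A) (sub (substLast (raw (substitute (day y z idP)))) X)
      ≡⟨ cong (λ w → rename (to A) (sub (substLast w) X)) (trans (raw-substitute _) (rename-id (λ _ → refl) _)) ⟩
    rename (to A) (sub (substLast W) X)
      ≡⟨ rename-sub (λ _ → refl) X ⟩
    sub (rename (to A) ∘ substLast W) X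
      ≡⟨ sub-cong outer X ⟩
    sub (rename (to f) ∘ sub (substLast Z) ∘ rename (to G) ∘ substLast Y) X
      ≡⟨ rename-sub-rename-sub (to f) (substLast Z) (to G) (substLast Y) X ⟨
    rename (to f) (sub (substLast Z) (rename (to G) (sub (substLast Y) X)))
      ≡⟨ cong (rename (to f) ∘ sub (substLast Z)) (raw-substitute (day x y G)) ⟨
    rename (to f) (sub (substLast Z) (raw (substitute (day x y G))))
      ≡⟨ raw-substitute _ ⟨
    raw (substitute (day (substitute (day x y G)) z f)) ∎)
    where
    open ≡-Reasoning
    X : Tm (m₁ + 1)
    X = raw x
    Y : Tm (m₂ + 1)
    Y = raw y
    Z : Tm m₃
    Z = raw z
    W : Tm (m₂ + m₃)
    W = sub (substLast Z) Y
    A : Perm (m₁ + (m₂ + m₃)) n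
    A = f ∘ₚ reassoc {m₁} {m₂} m₃ g
    G : Perm (m₁ + (m₂ + 1)) (k₁ + 1)
    G = reassoc {m₁} {m₂} 1 g

    inner : rename (to A ∘ (m₁ ↑ʳ_)) ∘ substLast Z ≗ rename (to f) ∘ substLast Z ∘ to G ∘ (m₁ ↑ʳ_)
    inner j with split m₂ 1 j
    ... | left t refl = begin
      rename (to A ∘ (m₁ ↑ʳ_)) (substLast Z (t ↑ˡ 1))   ≡⟨ cong (rename _) (substLast-↑ˡ Z t) ⟩
      var (to f (to (reassoc {m₁} {m₂} m₃ g) (m₁ ↑ʳ (t ↑ˡ m₃))))  ≡⟨ cong (var ∘ to f) (reassoc-↑ʳ↑ˡ {m₁} {m₂} m₃ g t) ⟩
      var (to f (to g (m₁ ↑ʳ t) ↑ˡ m₃))                 ≡⟨ cong (rename (to f)) (substLast-↑ˡ Z _) ⟨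
      rename (to f) (substLast Z (to g (m₁ ↑ʳ t) ↑ˡ 1)) ≡⟨ cong (rename (to f) ∘ substLast Z) (reassoc-↑ʳ↑ˡ {m₁} {m₂} 1 g t) ⟨
      rename (to f) (substLast Z (to G (m₁ ↑ʳ (t ↑ˡ 1)))) ∎
    ... | right q refl = begin
      rename (to A ∘ (m₁ ↑ʳ_)) (substLast Z (m₂ ↑ʳ q))  ≡⟨ cong (rename _) (substLast-↑ʳ Z q) ⟩
      rename (to A ∘ (m₁ ↑ʳ_)) (rename (m₂ ↑ʳ_) Z)      ≡⟨ rename-∘≗ (λ r → cong (to f) (reassoc-↑ʳ↑ʳ {m₁} {m₂} m₃ g r)) Z ⟩
      rename (to f ∘ (k₁ ↑ʳ_)) Z                         ≡⟨ rename-∘ (to f) (k₁ ↑ʳ_) Z ⟨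
      rename (to f) (rename (k₁ ↑ʳ_) Z)                  ≡⟨ cong (rename (to f)) (substLast-↑ʳ Z q) ⟨
      rename (to f) (substLast Z (k₁ ↑ʳ q))              ≡⟨ cong (rename (to f) ∘ substLast Z) (reassoc-↑ʳ↑ʳ {m₁} {m₂} 1 g q) ⟨
      rename (to f) (substLast Z (to G (m₁ ↑ʳ (m₂ ↑ʳ q)))) ∎

    outer : rename (to A) ∘ substLast W ≗ rename (to f) ∘ sub (substLast Z) ∘ rename (to G) ∘ substLast Y
    outer i with split m₁ 1 i
    ... | left t refl = begin
      rename (to A) (substLast W (t ↑ˡ 1))                ≡⟨ cong (rename (to A)) (substLast-↑ˡ W t) ⟩
      var (to f (to (reassoc {m₁} {m₂} m₃ g) (t ↑ˡ (m₂ + m₃))))     ≡⟨ cong (var ∘ to f) (reassoc-↑ˡ {m₁} {m₂} m₃ g t) ⟩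
      var (to f (to g (t ↑ˡ m₂) ↑ˡ m₃))                   ≡⟨ cong (rename (to f)) (substLast-↑ˡ Z _) ⟨
      rename (to f) (substLast Z (to g (t ↑ˡ m₂) ↑ˡ 1))   ≡⟨ cong (rename (to f) ∘ substLast Z) (reassoc-↑ˡ {m₁} {m₂} 1 g t) ⟨
      rename (to f) (substLast Z (to G (t ↑ˡ (m₂ + 1))))  ≡⟨ cong (rename (to f) ∘ sub (substLast Z) ∘ rename (to G)) (substLast-↑ˡ Y t) ⟨
      rename (to f) (sub (substLast Z) (rename (to G) (substLast Y (t ↑ˡ 1)))) ∎
    ... | right w refl = begin
      rename (to A) (substLast W (m₁ ↑ʳ w))               ≡⟨ cong (rename (to A)) (substLast-↑ʳ W w) ⟩
      rename (to A) (rename (m₁ ↑ʳ_) W)                   ≡⟨ rename-∘ (to A) (m₁ ↑ʳ_) W ⟩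
      rename (to A ∘ (m₁ ↑ʳ_)) (sub (substLast Z) Y)      ≡⟨ rename-sub (λ _ → refl) Y ⟩
      sub (rename (to A ∘ (m₁ ↑ʳ_)) ∘ substLast Z) Y      ≡⟨ sub-cong inner Y ⟩
      sub (rename (to f) ∘ substLast Z ∘ to G ∘ (m₁ ↑ʳ_)) Y ≡⟨ rename-sub-rename (to f) (substLast Z) (to G ∘ (m₁ ↑ʳ_)) Y ⟨
      rename (to f) (sub (substLast Z) (rename (to G ∘ (m₁ ↑ʳ_)) Y))
        ≡⟨ cong (rename (to f) ∘ sub (substLast Z)) (rename-∘ (to G) (m₁ ↑ʳ_) Y) ⟨
      rename (to f) (sub (substLast Z) (rename (to G) (rename (m₁ ↑ʳ_) Y)))
        ≡⟨ cong (rename (to f) ∘ sub (substLast Z) ∘ rename (to G)) (substLast-↑ʳ Y w) ⟨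
      rename (to f) (sub (substLast Z) (rename (to G) (substLast Y (m₁ ↑ʳ w)))) ∎

  σ-exchange : ∀ n (e : DayEl (Day (δ (δ T)) T) T n) →
               Eq T n (fun σ (((λ e′ → fun σ (str-rep (δ T) T e′)) ⊗₁ (λ z → z)) e))
                      (fun σ (((λ e′ → fun σ (str-rep (δ T) T e′)) ⊗₁ (λ z → z))
                        (assocInv-rep (δ (δ T)) T T
                          ((_⊗₁_ {δ (δ T)} {δ (δ T)} {Day T T} {Day T T} (λ z → z) (γ-rep T T))
                            ((swap-rep T ⊗₁ (λ z → z)) (assoc-rep (δ (δ T)) T T e))))))
  σ-exchange n (day {k₁} {m₃} (day {m₁} {m₂} x y g) z f) = raw-injective (begin
    raw (substitute (day (substitute (day x y G)) z f))
      ≡⟨ trans (raw-substitute _) (cong (rename (to f) ∘ sub (substLast Z)) (raw-substitute (day x y G))) ⟩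
    rename (to f) (sub (substLast Z) (rename (to G) (sub (substLast Y) X)))
      ≡⟨ rename-sub-rename-sub (to f) (substLast Z) (to G) (substLast Y) X ⟩
    sub L X
      ≡⟨ sub-cong pointwise X ⟩
    sub (R ∘ to (swapPerm m₁)) X
      ≡⟨ sub-rename (λ _ → refl) X ⟨
    sub R (rename (to (swapPerm m₁)) X)
      ≡⟨ rename-sub-rename-sub (to B) (substLast Y) (to G′) (substLast Z) (rename (to (swapPerm m₁)) X) ⟨
    rename (to B) (sub (substLast Y) (rename (to G′) (sub (substLast Z) (rename (to (swapPerm m₁)) X))))
      ≡⟨ cong (rename (to B) ∘ sub (substLast Y)) (trans (raw-substitute (day (act T (swapPerm m₁) x) z G′))
                                                          (cong (rename (to G′) ∘ sub (substLast Z)) (raw-act (swapPerm m₁) x))) ⟨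
    rename (to B) (sub (substLast Y) (raw (substitute (day (act T (swapPerm m₁) x) z G′))))
      ≡⟨ raw-substitute _ ⟨
    raw (substitute (day (substitute (day (act T (swapPerm m₁) x) z G′)) y B)) ∎)
    where
    open ≡-Reasoning
    X : Tm ((m₁ + 1) + 1)
    X = raw x
    Y : Tm m₂
    Y = raw y
    Z : Tm m₃
    Z = raw z
    G : Perm ((m₁ + 1) + m₂) (k₁ + 1)
    G = sendBack {m₁} {m₂} 1 g
    G′ : Perm ((m₁ + 1) + m₃) ((m₁ + m₃) + 1)
    G′ = sendBack {m₁} {m₃} 1 (idP {m₁ + m₃})
    A : Perm (m₁ + (m₂ + m₃)) n
    A = f ∘ₚ reassoc {m₁} {m₂} m₃ g
    B : Perm ((m₁ + m₃) + m₂) n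
    B = A ∘ₚ assocSwap m₁ m₃ m₂

    L : Fin ((m₁ + 1) + 1) → Tm n
    L = rename (to f) ∘ sub (substLast Z) ∘ rename (to G) ∘ substLast Y
    R : Fin ((m₁ + 1) + 1) → Tm n
    R = rename (to B) ∘ sub (substLast Y) ∘ rename (to G′) ∘ substLast Z

    A-↑ˡ : ∀ t → to A (t ↑ˡ (m₂ + m₃)) ≡ to f (to g (t ↑ˡ m₂) ↑ˡ m₃)
    A-↑ˡ t = cong (to f) (reassoc-↑ˡ {m₁} {m₂} m₃ g t)

    A-↑ʳ↑ˡ : ∀ j → to A (m₁ ↑ʳ (j ↑ˡ m₃)) ≡ to f (to g (m₁ ↑ʳ j) ↑ˡ m₃)
    A-↑ʳ↑ˡ j = cong (to f) (reassoc-↑ʳ↑ˡ {m₁} {m₂} m₃ g j)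

    A-↑ʳ↑ʳ : ∀ q → to A (m₁ ↑ʳ (m₂ ↑ʳ q)) ≡ to f (k₁ ↑ʳ q)
    A-↑ʳ↑ʳ q = cong (to f) (reassoc-↑ʳ↑ʳ {m₁} {m₂} m₃ g q)

    old : ∀ t → L ((t ↑ˡ 1) ↑ˡ 1) ≡ R ((t ↑ˡ 1) ↑ˡ 1)
    old t = begin
      rename (to f) (sub (substLast Z) (rename (to G) (substLast Y ((t ↑ˡ 1) ↑ˡ 1))))
        ≡⟨ cong (rename (to f) ∘ sub (substLast Z) ∘ rename (to G)) (substLast-↑ˡ Y (t ↑ˡ 1)) ⟩
      rename (to f) (substLast Z (to G ((t ↑ˡ 1) ↑ˡ m₂)))  ≡⟨ cong (rename (to f) ∘ substLast Z) (sendBack-↑ˡ {m₁} {m₂} 1 g t) ⟩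
      rename (to f) (substLast Z (to g (t ↑ˡ m₂) ↑ˡ 1))    ≡⟨ cong (rename (to f)) (substLast-↑ˡ Z _) ⟩
      var (to f (to g (t ↑ˡ m₂) ↑ˡ m₃))                    ≡⟨ cong var (trans (cong (to A) (assocSwap-↑ˡ m₁ m₃ m₂ t)) (A-↑ˡ t)) ⟨
      var (to B ((t ↑ˡ m₃) ↑ˡ m₂))                         ≡⟨ cong (rename (to B)) (substLast-↑ˡ Y _) ⟨
      rename (to B) (substLast Y ((t ↑ˡ m₃) ↑ˡ 1))         ≡⟨ cong (rename (to B) ∘ substLast Y) (sendBack-↑ˡ {m₁} {m₃} 1 idP t) ⟨
      rename (to B) (substLast Y (to G′ ((t ↑ˡ 1) ↑ˡ m₃)))
        ≡⟨ cong (rename (to B) ∘ sub (substLast Y) ∘ rename (to G′)) (substLast-↑ˡ Z (t ↑ˡ 1)) ⟨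
      R ((t ↑ˡ 1) ↑ˡ 1) ∎

    inner : ∀ w → L ((m₁ ↑ʳ w) ↑ˡ 1) ≡ R ((m₁ + 1) ↑ʳ w)
    inner w = begin
      rename (to f) (sub (substLast Z) (rename (to G) (substLast Y ((m₁ ↑ʳ w) ↑ˡ 1))))
        ≡⟨ cong (rename (to f) ∘ sub (substLast Z) ∘ rename (to G)) (substLast-↑ˡ Y (m₁ ↑ʳ w)) ⟩
      rename (to f) (substLast Z (to G ((m₁ ↑ʳ w) ↑ˡ m₂)))  ≡⟨ cong (rename (to f) ∘ substLast Z) (sendBack-↑ʳ↑ˡ {m₁} {m₂} 1 g w) ⟩
      rename (to f) (substLast Z (k₁ ↑ʳ w))                  ≡⟨ cong (rename (to f)) (substLast-↑ʳ Z w) ⟩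
      rename (to f) (rename (k₁ ↑ʳ_) Z)                      ≡⟨ rename-∘ (to f) (k₁ ↑ʳ_) Z ⟩
      rename (to f ∘ (k₁ ↑ʳ_)) Z                             ≡⟨ sub-var via-B Z ⟨
      sub (rename (to B) ∘ substLast Y ∘ to G′ ∘ ((m₁ + 1) ↑ʳ_)) Z
        ≡⟨ rename-sub-rename (to B) (substLast Y) (to G′ ∘ ((m₁ + 1) ↑ʳ_)) Z ⟨
      rename (to B) (sub (substLast Y) (rename (to G′ ∘ ((m₁ + 1) ↑ʳ_)) Z))
        ≡⟨ cong (rename (to B) ∘ sub (substLast Y)) (trans (cong (rename (to G′)) (substLast-↑ʳ Z w))
                                                           (rename-∘ (to G′) ((m₁ + 1) ↑ʳ_) Z)) ⟨
      R ((m₁ + 1) ↑ʳ w) ∎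
      where
      via-B : rename (to B) ∘ substLast Y ∘ to G′ ∘ ((m₁ + 1) ↑ʳ_) ≗ var ∘ to f ∘ (k₁ ↑ʳ_)
      via-B q = begin
        rename (to B) (substLast Y (to G′ ((m₁ + 1) ↑ʳ q)))  ≡⟨ cong (rename (to B) ∘ substLast Y) (sendBack-↑ʳ {m₁} {m₃} 1 idP q) ⟩
        rename (to B) (substLast Y ((m₁ ↑ʳ q) ↑ˡ 1))         ≡⟨ cong (rename (to B)) (substLast-↑ˡ Y _) ⟩
        var (to B ((m₁ ↑ʳ q) ↑ˡ m₂))                         ≡⟨ cong var (trans (cong (to A) (assocSwap-↑ʳ↑ˡ m₁ m₃ m₂ q)) (A-↑ʳ↑ʳ q)) ⟩
        var (to f (k₁ ↑ʳ q))                                  ∎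

    last : ∀ w → L ((m₁ + 1) ↑ʳ w) ≡ R ((m₁ ↑ʳ w) ↑ˡ 1)
    last w = begin
      rename (to f) (sub (substLast Z) (rename (to G) (substLast Y ((m₁ + 1) ↑ʳ w))))
        ≡⟨ cong (rename (to f) ∘ sub (substLast Z) ∘ rename (to G)) (substLast-↑ʳ Y w) ⟩
      rename (to f) (sub (substLast Z) (rename (to G) (rename ((m₁ + 1) ↑ʳ_) Y)))
        ≡⟨ cong (rename (to f) ∘ sub (substLast Z)) (rename-∘ (to G) ((m₁ + 1) ↑ʳ_) Y) ⟩
      rename (to f) (sub (substLast Z) (rename (to G ∘ ((m₁ + 1) ↑ʳ_)) Y))
        ≡⟨ rename-sub-rename (to f) (substLast Z) (to G ∘ ((m₁ + 1) ↑ʳ_)) Y ⟩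
      sub (rename (to f) ∘ substLast Z ∘ to G ∘ ((m₁ + 1) ↑ʳ_)) Y  ≡⟨ sub-var via-G Y ⟩
      rename (to B ∘ ((m₁ + m₃) ↑ʳ_)) Y                            ≡⟨ rename-∘ (to B) ((m₁ + m₃) ↑ʳ_) Y ⟨
      rename (to B) (rename ((m₁ + m₃) ↑ʳ_) Y)                     ≡⟨ cong (rename (to B)) (substLast-↑ʳ Y w) ⟨
      rename (to B) (substLast Y ((m₁ + m₃) ↑ʳ w))                 ≡⟨ cong (rename (to B) ∘ substLast Y) (sendBack-↑ʳ↑ˡ {m₁} {m₃} 1 idP w) ⟨
      rename (to B) (substLast Y (to G′ ((m₁ ↑ʳ w) ↑ˡ m₃)))
        ≡⟨ cong (rename (to B) ∘ sub (substLast Y) ∘ rename (to G′)) (substLast-↑ˡ Z (m₁ ↑ʳ w)) ⟨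
      R ((m₁ ↑ʳ w) ↑ˡ 1) ∎
      where
      via-G : rename (to f) ∘ substLast Z ∘ to G ∘ ((m₁ + 1) ↑ʳ_) ≗ var ∘ to B ∘ ((m₁ + m₃) ↑ʳ_)
      via-G j = begin
        rename (to f) (substLast Z (to G ((m₁ + 1) ↑ʳ j)))  ≡⟨ cong (rename (to f) ∘ substLast Z) (sendBack-↑ʳ {m₁} {m₂} 1 g j) ⟩
        rename (to f) (substLast Z (to g (m₁ ↑ʳ j) ↑ˡ 1))   ≡⟨ cong (rename (to f)) (substLast-↑ˡ Z _) ⟩
        var (to f (to g (m₁ ↑ʳ j) ↑ˡ m₃))                   ≡⟨ cong var (trans (cong (to A) (assocSwap-↑ʳ m₁ m₃ m₂ j)) (A-↑ʳ↑ˡ j)) ⟨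
        var (to B ((m₁ + m₃) ↑ʳ j))                         ∎

    pointwise : L ≗ R ∘ to (swapPerm m₁)
    pointwise ℓ with split (m₁ + 1) 1 ℓ
    ... | right w refl = trans (last w) (cong R (sym (swapPerm-↑ʳ w)))
    ... | left ℓ′ refl with split m₁ 1 ℓ′
    ...   | left t refl = trans (old t) (cong R (sym (swapPerm-↑ˡ t)))
    ...   | right w refl = trans (inner w) (cong R (sym (swapPerm-↑ʳ↑ˡ w)))

mainTheorem8 : (S : BindingSig) (T : Species) (η : Hom V T) (φ : Hom (ΣF S T) T) →
    IsInitialAlg S T η φ →
    Σ (Hom (Day (δ T) T) T) (λ σ → Σ (Hom J (δ T)) (λ ν → IsLinSubstAlg T σ ν))
mainTheorem8 S T η φ init =
  σ , ν , record { law-a = σ-ν-unitˡ ; law-b = σ-ν-unitʳ ; law-c = σ-assoc ; law-d = σ-exchange }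
  where open Model S T η φ init
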